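{- Let $A\in\mathbf{Z}[T]$ be a monic, reducible, reciprocal polynomial of degree $2m$. Then one of the following holds: - $A$ has a monic reciprocal divisor in $\mathbf{Z}[T]$ of degree $2k$ for some integer $k\ge1$ with $2k\le m$; - there exist a monic irreducible polynomial $I\in\mathbf{Z}[T]$ of degree $m$ and a sign $u\in\{\pm1\}$ such that $A=u\,I\cdot I_{\mathsf{rev}}$.
   Context: A polynomial $A$ over a field is reciprocal if $A=0$, or if $A$ has even degree and $A(T)=T^{\deg A}A(1/T)$. For a nonzero polynomial $F$, $F_{\mathsf{rev}}(T)=T^{\deg F}F(1/T)$. -}

module Defs where

open import Data.Nat using (ℕ; zero; suc; _∸_)
open import Data.Integer using (ℤ; +_; -[1+_]; _+_; _*_)
open import Data.List using (List; []; _∷_; reverse; length)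
open import Data.Product using (Σ; ∃; _×_; _,_)
open import Data.Sum using (_⊎_)
open import Relation.Binary.PropositionalEquality using (_≡_)
open import Relation.Nullary using (¬_)

-- Polynomials in ℤ[T] are represented by coefficient lists, lowest degree
-- first: a₀ ∷ a₁ ∷ … ∷ aₙ ∷ [] stands for a₀ + a₁ T + … + aₙ Tⁿ.
-- Trailing zero coefficients are allowed; polynomial equality is
-- equality after trimming them.
Poly : Set
Poly = List ℤ

dropZeros : List ℤ → List ℤ
dropZeros [] = []
dropZeros (+ zero ∷ xs) = dropZeros xs
dropZeros (x ∷ xs) = x ∷ xs

trim : Poly → Poly
trim p = reverse (dropZeros (reverse p))

_≈ₚ_ : Poly → Poly → Set
p ≈ₚ q = trim p ≡ trim q

infix 4 _≈ₚ_

0ₚ : Poly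
0ₚ = []

1ₚ : Poly
1ₚ = + 1 ∷ []

_+ₚ_ : Poly → Poly → Poly
[] +ₚ q = q
(a ∷ p) +ₚ [] = a ∷ p
(a ∷ p) +ₚ (b ∷ q) = (a + b) ∷ (p +ₚ q)

scale : ℤ → Poly → Poly
scale c [] = []
scale c (a ∷ p) = (c * a) ∷ scale c p

_*ₚ_ : Poly → Poly → Poly
[] *ₚ q = []
(a ∷ p) *ₚ q = scale a q +ₚ (+ 0 ∷ (p *ₚ q))

infixl 6 _+ₚ_
infixl 7 _*ₚ_

-- degree (of a nonzero polynomial; deg 0 is set to 0 by convention,
-- it is only ever used on nonzero polynomials)
deg : Poly → ℕ
deg p = length (trim p) ∸ 1

lastOr0 : List ℤ → ℤ
lastOr0 [] = + 0
lastOr0 (x ∷ []) = x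
lastOr0 (x ∷ y ∷ xs) = lastOr0 (y ∷ xs)

lead : Poly → ℤ
lead p = lastOr0 (trim p)

Monic : Poly → Set
Monic p = lead p ≡ + 1

-- F_rev(T) = T^{deg F} F(1/T): reverse the trimmed coefficient list
rev : Poly → Poly
rev p = reverse (trim p)

Even : ℕ → Set
Even n = ∃ λ k → n ≡ k Data.Nat.+ k
  where import Data.Nat

Reciprocal : Poly → Set
Reciprocal a = (a ≈ₚ 0ₚ) ⊎ (Even (deg a) × (a ≈ₚ rev a))

_∣ₚ_ : Poly → Poly → Set
d ∣ₚ a = ∃ λ q → a ≈ₚ d *ₚ q

IsUnit : Poly → Set
IsUnit p = ∃ λ q → p *ₚ q ≈ₚ 1ₚ

Irreducible : Poly → Set
Irreducible p = ¬ (p ≈ₚ 0ₚ) × ¬ IsUnit p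
  × (∀ f g → p ≈ₚ f *ₚ g → IsUnit f ⊎ IsUnit g)

Reducible : Poly → Set
Reducible p = ¬ (p ≈ₚ 0ₚ) × ¬ IsUnit p
  × (∃ λ f → ∃ λ g → ¬ IsUnit f × ¬ IsUnit g × (p ≈ₚ f *ₚ g))

-- Write A* for T^(2m) A(1/T), so that A = A*. If A(a) = 0 for a = ±1, then A = (T - a) G with G = -a G*,
-- which forces G(a) = 0, so (T - a)² is a reciprocal divisor of degree 2. Otherwise take a monic irreducible
-- factor F of A of degree d, found constructively by Kronecker's method. Its constant term c is ±1 and
-- F̃ = c F* is a monic irreducible factor as well. If F = F̃, then F(1) ≠ 0 ≠ F(-1) forces c = 1 and d even,
-- so F is reciprocal; otherwise Euclid's lemma makes F F̃ a reciprocal divisor of degree 2d. The cofactor of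
-- a monic reciprocal divisor D is reciprocal, so D or its cofactor has degree at most m, unless A = D; that
-- contradicts reducibility when D = F, and gives A = c F F* when D = F F̃.
module Submission where

open import Defs
open import Data.Nat using (ℕ; _≤_; _*_)
open import Data.Integer using (ℤ; +_; -[1+_])
open import Data.Product using (∃; _×_)
open import Data.Sum using (_⊎_)
open import Relation.Binary.PropositionalEquality using (_≡_)

open import Data.Empty using (⊥; ⊥-elim)
open import Data.Integer using (_+_; -_; _-_; _^_; 0ℤ; 1ℤ) renaming (_*_ to _·_)
import Data.Integer as ℤ
import Data.Integer.Divisibility.Signed as DS
import Data.Integer.Properties as ZP
open import Data.Integer.Tactic.RingSolver using (solve-∀)
open import Data.List using (List; []; _∷_; _++_; reverse; length; map)
import Data.List.Properties as LP
open import Data.List.Relation.Unary.All using (_∷_)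
open import Data.Maybe using (Maybe; just; nothing; _>>=_)
open import Data.Nat using (zero; suc; z≤n; s≤s; _<_; _∸_) renaming (_+_ to _+ℕ_)
import Data.Nat as N
import Data.Nat.Divisibility as ND
open import Data.Nat.ListAction using (product)
open import Data.Nat.Primality using (Prime; euclidsLemma; prime⇒nonTrivial)
open import Data.Nat.Primality.Factorisation using (factorise)
import Data.Nat.Properties as NP
import Data.Nat.Tactic.RingSolver as NS
open import Data.Product using (Σ; _,_; proj₁; proj₂)
open import Data.Sum using (inj₁; inj₂)
import Data.Sum as Sum
open import Data.Unit using (⊤; tt)
open import Function using (_∘_)
open import Relation.Binary.Bundles using (Setoid)
open import Relation.Binary.Definitions using (tri<; tri≈; tri>)
open import Relation.Binary.PropositionalEquality
  using (refl; sym; trans; cong; cong₂; subst; subst₂; _≢_; module ≡-Reasoning)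
import Relation.Binary.Reasoning.Setoid as SetoidReasoning
open import Relation.Binary.Structures using (IsEquivalence)
open import Relation.Nullary using (¬_; Dec; yes; no)
open import Relation.Nullary.Decidable using (toSum)

coeff : Poly → ℕ → ℤ
coeff [] n = 0ℤ
coeff (a ∷ p) zero = a
coeff (a ∷ p) (suc n) = coeff p n

-- Coefficientwise equality: it coincides with _≈ₚ_ (≈⇒≋, ≋⇒≈) but needs no trimming to reason with.
infix 4 _≋_
record _≋_ (p q : Poly) : Set where
  constructor mk≋
  field at : ∀ n → coeff p n ≡ coeff q n
open _≋_ public

≋-refl : ∀ {p} → p ≋ p
≋-refl = mk≋ λ n → refl

≋-reflexive : ∀ {p q} → p ≡ q → p ≋ q
≋-reflexive refl = ≋-refl

≋-sym : ∀ {p q} → p ≋ q → q ≋ p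
≋-sym h = mk≋ λ n → sym (at h n)

≋-trans : ∀ {p q r} → p ≋ q → q ≋ r → p ≋ r
≋-trans h g = mk≋ λ n → trans (at h n) (at g n)

≋-isEquivalence : IsEquivalence _≋_
≋-isEquivalence = record { refl = ≋-refl ; sym = ≋-sym ; trans = ≋-trans }

≋-setoid : Setoid _ _
≋-setoid = record { isEquivalence = ≋-isEquivalence }

module ≋-Reasoning = SetoidReasoning ≋-setoid

smartCons : ℤ → Poly → Poly
smartCons a (x ∷ xs) = a ∷ x ∷ xs
smartCons (+ zero) [] = []
smartCons (+ suc k) [] = + suc k ∷ []
smartCons -[1+ k ] [] = -[1+ k ] ∷ []

dropZeros-++-zeros : ∀ xs ys → dropZeros xs ≡ [] → dropZeros (xs ++ ys) ≡ dropZeros ys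
dropZeros-++-zeros [] ys h = refl
dropZeros-++-zeros (+ zero ∷ xs) ys h = dropZeros-++-zeros xs ys h
dropZeros-++-zeros (+ suc k ∷ xs) ys ()
dropZeros-++-zeros (-[1+ k ] ∷ xs) ys ()

dropZeros-++-nonzero : ∀ xs ys → ¬ (dropZeros xs ≡ []) → dropZeros (xs ++ ys) ≡ dropZeros xs ++ ys
dropZeros-++-nonzero [] ys h = ⊥-elim (h refl)
dropZeros-++-nonzero (+ zero ∷ xs) ys h = dropZeros-++-nonzero xs ys h
dropZeros-++-nonzero (+ suc k ∷ xs) ys h = refl
dropZeros-++-nonzero (-[1+ k ] ∷ xs) ys h = refl

smartCons-nonEmpty : ∀ a l → ¬ (l ≡ []) → smartCons a l ≡ a ∷ l
smartCons-nonEmpty a [] h = ⊥-elim (h refl)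
smartCons-nonEmpty a (x ∷ l) h = refl

reverse-∷≢[] : ∀ (y : ℤ) ys → ¬ (reverse (y ∷ ys) ≡ [])
reverse-∷≢[] y ys e = NP.1+n≢0 (trans (sym (LP.length-reverse (y ∷ ys))) (cong length e))

reverse-dropZeros-[_] : ∀ a → reverse (dropZeros (a ∷ [])) ≡ smartCons a []
reverse-dropZeros-[_] (+ zero) = refl
reverse-dropZeros-[_] (+ suc k) = refl
reverse-dropZeros-[_] -[1+ k ] = refl

trim-∷ : ∀ a p → trim (a ∷ p) ≡ smartCons a (trim p)
trim-∷ a p with dropZeros (reverse p) in eq
... | [] = begin
    reverse (dropZeros (reverse (a ∷ p))) ≡⟨ cong (λ z → reverse (dropZeros z)) (LP.unfold-reverse a p) ⟩
    reverse (dropZeros (reverse p ++ a ∷ [])) ≡⟨ cong reverse (dropZeros-++-zeros (reverse p) (a ∷ []) eq) ⟩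
    reverse (dropZeros (a ∷ [])) ≡⟨ reverse-dropZeros-[_] a ⟩
    smartCons a [] ∎
  where open ≡-Reasoning
... | y ∷ ys = begin
    reverse (dropZeros (reverse (a ∷ p))) ≡⟨ cong (λ z → reverse (dropZeros z)) (LP.unfold-reverse a p) ⟩
    reverse (dropZeros (reverse p ++ a ∷ []))
      ≡⟨ cong reverse (dropZeros-++-nonzero (reverse p) (a ∷ []) (λ e → y∷ys≢[] (trans (sym eq) e))) ⟩
    reverse (dropZeros (reverse p) ++ a ∷ []) ≡⟨ cong (λ z → reverse (z ++ a ∷ [])) eq ⟩
    reverse ((y ∷ ys) ++ a ∷ []) ≡⟨ LP.reverse-++ (y ∷ ys) (a ∷ []) ⟩
    a ∷ reverse (y ∷ ys) ≡⟨ sym (smartCons-nonEmpty a _ (reverse-∷≢[] y ys)) ⟩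
    smartCons a (reverse (y ∷ ys)) ∎
  where
  open ≡-Reasoning
  y∷ys≢[] : ¬ (y ∷ ys ≡ [])
  y∷ys≢[] ()

coeff-smartCons : ∀ a l n → coeff (smartCons a l) n ≡ coeff (a ∷ l) n
coeff-smartCons a (x ∷ l) n = refl
coeff-smartCons (+ zero) [] zero = refl
coeff-smartCons (+ zero) [] (suc n) = refl
coeff-smartCons (+ suc k) [] n = refl
coeff-smartCons -[1+ k ] [] n = refl

coeff-trim : ∀ p n → coeff (trim p) n ≡ coeff p n
coeff-trim [] n = refl
coeff-trim (a ∷ p) n rewrite trim-∷ a p = trans (coeff-smartCons a (trim p) n) (coeff-∷-trim n)
  where
  coeff-∷-trim : ∀ n → coeff (a ∷ trim p) n ≡ coeff (a ∷ p) n
  coeff-∷-trim zero = refl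
  coeff-∷-trim (suc n) = coeff-trim p n

≈⇒≋ : ∀ {p q} → p ≈ₚ q → p ≋ q
≈⇒≋ {p} {q} e = mk≋ λ n → trans (sym (coeff-trim p n)) (trans (cong (λ z → coeff z n) e) (coeff-trim q n))

≋-tail : ∀ {a b p q} → (a ∷ p) ≋ (b ∷ q) → p ≋ q
≋-tail h = mk≋ λ n → at h (suc n)
≋-tailˡ : ∀ {b q} → [] ≋ (b ∷ q) → [] ≋ q
≋-tailˡ h = mk≋ λ n → at h (suc n)
≋-tailʳ : ∀ {a p} → (a ∷ p) ≋ [] → p ≋ []
≋-tailʳ h = mk≋ λ n → at h (suc n)

≋⇒≈ : ∀ p q → p ≋ q → p ≈ₚ q
≋⇒≈ [] [] h = refl
≋⇒≈ [] (b ∷ q) h rewrite trim-∷ b q | sym (at h 0) | sym (≋⇒≈ [] q (≋-tailˡ h)) = refl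
≋⇒≈ (a ∷ p) [] h rewrite trim-∷ a p | at h 0 | ≋⇒≈ p [] (≋-tailʳ h) = refl
≋⇒≈ (a ∷ p) (b ∷ q) h rewrite trim-∷ a p | trim-∷ b q | at h 0 | ≋⇒≈ p q (≋-tail h) = refl

Deg≤ : Poly → ℕ → Set
Deg≤ p n = ∀ k → n < k → coeff p k ≡ 0ℤ

Deg< : Poly → ℕ → Set
Deg< p n = ∀ k → n ≤ k → coeff p k ≡ 0ℤ

Normalised : List ℤ → Set
Normalised l = lastOr0 l ≡ 0ℤ → l ≡ []

Normalised-smartCons : ∀ a l → Normalised l → Normalised (smartCons a l)
Normalised-smartCons a (x ∷ l) h e with h e
... | ()
Normalised-smartCons (+ zero) [] h e = refl
Normalised-smartCons (+ suc k) [] h ()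
Normalised-smartCons -[1+ k ] [] h ()

Normalised-trim : ∀ p → Normalised (trim p)
Normalised-trim [] e = refl
Normalised-trim (a ∷ p) rewrite trim-∷ a p = Normalised-smartCons a (trim p) (Normalised-trim p)

coeff-≥length : ∀ l k → length l ≤ k → coeff l k ≡ 0ℤ
coeff-≥length [] k h = refl
coeff-≥length (x ∷ l) (suc k) (s≤s h) = coeff-≥length l k h

coeff-last : ∀ l → coeff l (length l ∸ 1) ≡ lastOr0 l
coeff-last [] = refl
coeff-last (x ∷ []) = refl
coeff-last (x ∷ y ∷ l) = coeff-last (y ∷ l)

pred<⇒≤ : ∀ m k → m ∸ 1 < k → m ≤ k
pred<⇒≤ zero k h = z≤n
pred<⇒≤ (suc m) k h = h

Deg≤-deg : ∀ p → Deg≤ p (deg p)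
Deg≤-deg p k h = trans (sym (coeff-trim p k)) (coeff-≥length (trim p) k (pred<⇒≤ (length (trim p)) k h))

coeff-deg : ∀ p → coeff p (deg p) ≡ lead p
coeff-deg p = trans (sym (coeff-trim p (deg p))) (coeff-last (trim p))

lead≡0⇒≋[] : ∀ p → lead p ≡ 0ℤ → p ≋ []
lead≡0⇒≋[] p e = ≈⇒≋ {p} {[]} (Normalised-trim p e)

NonZeroₚ : Poly → Set
NonZeroₚ p = ¬ (p ≋ [])

lead≢0 : ∀ p → NonZeroₚ p → lead p ≢ 0ℤ
lead≢0 p nz e = nz (lead≡0⇒≋[] p e)

deg-unique : ∀ p n → Deg≤ p n → coeff p n ≢ 0ℤ → deg p ≡ n
deg-unique p n b nz with NP.<-cmp (deg p) n
... | tri< a _ _ = ⊥-elim (nz (Deg≤-deg p n a))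
... | tri≈ _ e _ = e
... | tri> _ _ c = ⊥-elim (lead≢0 p (λ z → nz (at z n)) (trans (sym (coeff-deg p)) (b (deg p) c)))

deg-≋[] : ∀ p → p ≋ [] → deg p ≡ 0
deg-≋[] p h = cong (λ l → length l ∸ 1) (≋⇒≈ p [] h)

Deg≤-mono : ∀ {p m n} → Deg≤ p m → m ≤ n → Deg≤ p n
Deg≤-mono b le k h = b k (NP.≤-<-trans le h)

Deg≤⇒deg≤ : ∀ p n → Deg≤ p n → deg p ≤ n
Deg≤⇒deg≤ p n p≤n with deg p N.≤? n
... | yes deg≤n = deg≤n
... | no deg≰n = ⊥-elim (lead≢0 p (λ p≋0 → deg≰n (subst (_≤ n) (sym (deg-≋[] p p≋0)) z≤n))
                    (trans (sym (coeff-deg p)) (p≤n (deg p) (NP.≰⇒> deg≰n))))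

deg≤⇒Deg≤ : ∀ p n → deg p ≤ n → Deg≤ p n
deg≤⇒Deg≤ p n deg≤n = Deg≤-mono {p} (Deg≤-deg p) deg≤n

i+j-i≡j : ∀ i j → i + j - i ≡ j
i+j-i≡j = solve-∀

coeff-+ₚ : ∀ p q n → coeff (p +ₚ q) n ≡ coeff p n + coeff q n
coeff-+ₚ [] q n = sym (ZP.+-identityˡ (coeff q n))
coeff-+ₚ (a ∷ p) [] zero = sym (ZP.+-identityʳ a)
coeff-+ₚ (a ∷ p) [] (suc n) = sym (ZP.+-identityʳ (coeff p n))
coeff-+ₚ (a ∷ p) (b ∷ q) zero = refl
coeff-+ₚ (a ∷ p) (b ∷ q) (suc n) = coeff-+ₚ p q n

coeff-scale : ∀ c p n → coeff (scale c p) n ≡ c · coeff p n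
coeff-scale c [] n = sym (ZP.*-zeroʳ c)
coeff-scale c (a ∷ p) zero = refl
coeff-scale c (a ∷ p) (suc n) = coeff-scale c p n

coeff-∷-*ₚ : ∀ a p q n → coeff ((a ∷ p) *ₚ q) n ≡ a · coeff q n + coeff (0ℤ ∷ (p *ₚ q)) n
coeff-∷-*ₚ a p q n =
  trans (coeff-+ₚ (scale a q) (0ℤ ∷ (p *ₚ q)) n) (cong (_+ coeff (0ℤ ∷ (p *ₚ q)) n) (coeff-scale a q n))

+ₚ-cong : ∀ {p p' q q'} → p ≋ p' → q ≋ q' → p +ₚ q ≋ p' +ₚ q'
+ₚ-cong {p} {p'} {q} {q'} h g =
  mk≋ λ n → trans (coeff-+ₚ p q n) (trans (cong₂ _+_ (at h n) (at g n)) (sym (coeff-+ₚ p' q' n)))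

scale-cong : ∀ {c p p'} → p ≋ p' → scale c p ≋ scale c p'
scale-cong {c} {p} {p'} h =
  mk≋ λ n → trans (coeff-scale c p n) (trans (cong (c ·_) (at h n)) (sym (coeff-scale c p' n)))

∷-cong : ∀ {a b p q} → a ≡ b → p ≋ q → (a ∷ p) ≋ (b ∷ q)
∷-cong e h = mk≋ λ { zero → e ; (suc n) → at h n }

*ₚ-congˡ : ∀ p {q q'} → q ≋ q' → p *ₚ q ≋ p *ₚ q'
*ₚ-congˡ [] h = ≋-refl
*ₚ-congˡ (a ∷ p) {q} {q'} h = mk≋ λ n → begin
  coeff ((a ∷ p) *ₚ q) n                  ≡⟨ coeff-∷-*ₚ a p q n ⟩
  a · coeff q n + coeff (0ℤ ∷ (p *ₚ q)) n   ≡⟨ cong₂ _+_ (cong (a ·_) (at h n)) (at (∷-cong refl (*ₚ-congˡ p h)) n) ⟩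
  a · coeff q' n + coeff (0ℤ ∷ (p *ₚ q')) n ≡⟨ coeff-∷-*ₚ a p q' n ⟨
  coeff ((a ∷ p) *ₚ q') n                 ∎
  where open ≡-Reasoning

+ₚ-comm : ∀ p q → p +ₚ q ≋ q +ₚ p
+ₚ-comm p q = mk≋ λ n → trans (coeff-+ₚ p q n) (trans (ZP.+-comm (coeff p n) (coeff q n)) (sym (coeff-+ₚ q p n)))

+ₚ-identityʳ : ∀ p → p +ₚ [] ≋ p
+ₚ-identityʳ p = mk≋ λ n → trans (coeff-+ₚ p [] n) (ZP.+-identityʳ (coeff p n))

*ₚ-zeroʳ : ∀ p → p *ₚ [] ≋ []
*ₚ-zeroʳ [] = ≋-refl
*ₚ-zeroʳ (a ∷ p) = mk≋ λ { zero → refl ; (suc n) → at (*ₚ-zeroʳ p) n }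

0∷-*ₚ : ∀ p q → (0ℤ ∷ p) *ₚ q ≋ 0ℤ ∷ (p *ₚ q)
0∷-*ₚ p q = mk≋ λ n → trans (coeff-∷-*ₚ 0ℤ p q n) (ZP.+-identityˡ _)

*ₚ-∷ : ∀ p b q → p *ₚ (b ∷ q) ≋ scale b p +ₚ (0ℤ ∷ (p *ₚ q))
*ₚ-∷ [] b q = mk≋ λ { zero → refl ; (suc n) → refl }
*ₚ-∷ (a ∷ p) b q = mk≋ λ
  { zero → begin
      coeff ((a ∷ p) *ₚ (b ∷ q)) 0                         ≡⟨ coeff-∷-*ₚ a p (b ∷ q) 0 ⟩
      a · b + 0ℤ                                           ≡⟨ cong (_+ 0ℤ) (ZP.*-comm a b) ⟩
      b · a + 0ℤ                                           ≡⟨ coeff-+ₚ (scale b (a ∷ p)) (0ℤ ∷ ((a ∷ p) *ₚ q)) 0 ⟨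
      coeff (scale b (a ∷ p) +ₚ (0ℤ ∷ ((a ∷ p) *ₚ q))) 0  ∎
  ; (suc n) → begin
      coeff ((a ∷ p) *ₚ (b ∷ q)) (suc n)                   ≡⟨ coeff-∷-*ₚ a p (b ∷ q) (suc n) ⟩
      a · coeff q n + coeff (p *ₚ (b ∷ q)) n               ≡⟨ cong (λ z → a · coeff q n + z) (at (*ₚ-∷ p b q) n) ⟩
      a · coeff q n + coeff (scale b p +ₚ (0ℤ ∷ (p *ₚ q))) n
        ≡⟨ cong (λ z → a · coeff q n + z) (trans (coeff-+ₚ (scale b p) _ n) (cong (_+ coeff (0ℤ ∷ (p *ₚ q)) n) (coeff-scale b p n))) ⟩
      a · coeff q n + (b · coeff p n + coeff (0ℤ ∷ (p *ₚ q)) n)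
        ≡⟨ +-left-commute (a · coeff q n) (b · coeff p n) (coeff (0ℤ ∷ (p *ₚ q)) n) ⟩
      b · coeff p n + (a · coeff q n + coeff (0ℤ ∷ (p *ₚ q)) n)
        ≡⟨ cong₂ _+_ (coeff-scale b p n) (coeff-∷-*ₚ a p q n) ⟨
      coeff (scale b p) n + coeff ((a ∷ p) *ₚ q) n         ≡⟨ coeff-+ₚ (scale b (a ∷ p)) (0ℤ ∷ ((a ∷ p) *ₚ q)) (suc n) ⟨
      coeff (scale b (a ∷ p) +ₚ (0ℤ ∷ ((a ∷ p) *ₚ q))) (suc n) ∎ }
  where
  open ≡-Reasoning
  +-left-commute : ∀ x y z → x + (y + z) ≡ y + (x + z)
  +-left-commute = solve-∀

*ₚ-comm : ∀ p q → p *ₚ q ≋ q *ₚ p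
*ₚ-comm [] q = ≋-sym (*ₚ-zeroʳ q)
*ₚ-comm (a ∷ p) q = ≋-trans (+ₚ-cong (≋-refl {scale a q}) (∷-cong refl (*ₚ-comm p q))) (≋-sym (*ₚ-∷ q a p))

*ₚ-congʳ : ∀ {p p'} q → p ≋ p' → p *ₚ q ≋ p' *ₚ q
*ₚ-congʳ {p} {p'} q h = ≋-trans (*ₚ-comm p q) (≋-trans (*ₚ-congˡ q h) (*ₚ-comm q p'))

*ₚ-cong : ∀ {p p' q q'} → p ≋ p' → q ≋ q' → p *ₚ q ≋ p' *ₚ q'
*ₚ-cong {p} {p'} {q} {q'} h g = ≋-trans (*ₚ-congʳ q h) (*ₚ-congˡ p' g)

scale-*ₚˡ : ∀ c p q → scale c p *ₚ q ≋ scale c (p *ₚ q)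
scale-*ₚˡ c [] q = ≋-refl
scale-*ₚˡ c (a ∷ p) q = mk≋ λ n → begin
  coeff ((c · a ∷ scale c p) *ₚ q) n                      ≡⟨ coeff-∷-*ₚ (c · a) (scale c p) q n ⟩
  c · a · coeff q n + coeff (0ℤ ∷ (scale c p *ₚ q)) n     ≡⟨ cong (λ z → c · a · coeff q n + z) (coeff-0∷-scale n) ⟩
  c · a · coeff q n + c · coeff (0ℤ ∷ (p *ₚ q)) n          ≡⟨ distrib (coeff q n) (coeff (0ℤ ∷ (p *ₚ q)) n) ⟩
  c · (a · coeff q n + coeff (0ℤ ∷ (p *ₚ q)) n)            ≡⟨ cong (c ·_) (coeff-∷-*ₚ a p q n) ⟨
  c · coeff ((a ∷ p) *ₚ q) n                              ≡⟨ coeff-scale c ((a ∷ p) *ₚ q) n ⟨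
  coeff (scale c ((a ∷ p) *ₚ q)) n                        ∎
  where
  open ≡-Reasoning
  coeff-0∷-scale : ∀ n → coeff (0ℤ ∷ (scale c p *ₚ q)) n ≡ c · coeff (0ℤ ∷ (p *ₚ q)) n
  coeff-0∷-scale zero = sym (ZP.*-zeroʳ c)
  coeff-0∷-scale (suc n) = trans (at (scale-*ₚˡ c p q) n) (coeff-scale c (p *ₚ q) n)
  distrib : ∀ x y → c · a · x + c · y ≡ c · (a · x + y)
  distrib x y = trans (cong (_+ c · y) (ZP.*-assoc c a x)) (sym (ZP.*-distribˡ-+ c (a · x) y))

scale-*ₚʳ : ∀ c p q → p *ₚ scale c q ≋ scale c (p *ₚ q)
scale-*ₚʳ c p q = ≋-trans (*ₚ-comm p (scale c q)) (≋-trans (scale-*ₚˡ c q p) (scale-cong (*ₚ-comm q p)))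

*ₚ-distribʳ-+ₚ : ∀ p p' q → (p +ₚ p') *ₚ q ≋ p *ₚ q +ₚ p' *ₚ q
*ₚ-distribʳ-+ₚ [] p' q = ≋-refl
*ₚ-distribʳ-+ₚ (a ∷ p) [] q = ≋-sym (+ₚ-identityʳ _)
*ₚ-distribʳ-+ₚ (a ∷ p) (b ∷ p') q = mk≋ λ n → begin
  coeff ((a + b ∷ (p +ₚ p')) *ₚ q) n
    ≡⟨ coeff-∷-*ₚ (a + b) (p +ₚ p') q n ⟩
  (a + b) · coeff q n + coeff (0ℤ ∷ ((p +ₚ p') *ₚ q)) n
    ≡⟨ cong (λ z → (a + b) · coeff q n + z) (coeff-0∷-+ n) ⟩
  (a + b) · coeff q n + (coeff (0ℤ ∷ (p *ₚ q)) n + coeff (0ℤ ∷ (p' *ₚ q)) n)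
    ≡⟨ distrib a b (coeff q n) (coeff (0ℤ ∷ (p *ₚ q)) n) (coeff (0ℤ ∷ (p' *ₚ q)) n) ⟩
  (a · coeff q n + coeff (0ℤ ∷ (p *ₚ q)) n) + (b · coeff q n + coeff (0ℤ ∷ (p' *ₚ q)) n)
    ≡⟨ cong₂ _+_ (coeff-∷-*ₚ a p q n) (coeff-∷-*ₚ b p' q n) ⟨
  coeff ((a ∷ p) *ₚ q) n + coeff ((b ∷ p') *ₚ q) n
    ≡⟨ coeff-+ₚ ((a ∷ p) *ₚ q) ((b ∷ p') *ₚ q) n ⟨
  coeff ((a ∷ p) *ₚ q +ₚ (b ∷ p') *ₚ q) n ∎
  where
  open ≡-Reasoning
  coeff-0∷-+ : ∀ n → coeff (0ℤ ∷ ((p +ₚ p') *ₚ q)) n ≡ coeff (0ℤ ∷ (p *ₚ q)) n + coeff (0ℤ ∷ (p' *ₚ q)) n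
  coeff-0∷-+ zero = refl
  coeff-0∷-+ (suc n) = trans (at (*ₚ-distribʳ-+ₚ p p' q) n) (coeff-+ₚ (p *ₚ q) (p' *ₚ q) n)
  distrib : ∀ a b x y z → (a + b) · x + (y + z) ≡ (a · x + y) + (b · x + z)
  distrib = solve-∀

*ₚ-distribˡ-+ₚ : ∀ p q q' → p *ₚ (q +ₚ q') ≋ p *ₚ q +ₚ p *ₚ q'
*ₚ-distribˡ-+ₚ p q q' =
  ≋-trans (*ₚ-comm p (q +ₚ q')) (≋-trans (*ₚ-distribʳ-+ₚ q q' p) (+ₚ-cong (*ₚ-comm q p) (*ₚ-comm q' p)))

*ₚ-assoc : ∀ p q r → (p *ₚ q) *ₚ r ≋ p *ₚ (q *ₚ r)
*ₚ-assoc [] q r = ≋-refl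
*ₚ-assoc (a ∷ p) q r = ≋-trans (*ₚ-distribʳ-+ₚ (scale a q) (0ℤ ∷ (p *ₚ q)) r)
  (+ₚ-cong (scale-*ₚˡ a q r) (≋-trans (0∷-*ₚ (p *ₚ q) r) (∷-cong refl (*ₚ-assoc p q r))))

[c]-*ₚ : ∀ c q → (c ∷ []) *ₚ q ≋ scale c q
[c]-*ₚ c q = mk≋ λ n → trans (coeff-∷-*ₚ c [] q n) (trans (drop-0 n) (sym (coeff-scale c q n)))
  where
  drop-0 : ∀ n → c · coeff q n + coeff (0ℤ ∷ []) n ≡ c · coeff q n
  drop-0 zero = ZP.+-identityʳ _
  drop-0 (suc n) = ZP.+-identityʳ _

*ₚ-identityˡ : ∀ q → 1ₚ *ₚ q ≋ q
*ₚ-identityˡ q = ≋-trans ([c]-*ₚ 1ℤ q) (mk≋ λ n → trans (coeff-scale 1ℤ q n) (ZP.*-identityˡ _))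

scale-scale : ∀ c d p → scale c (scale d p) ≋ scale (c · d) p
scale-scale c d p = mk≋ λ n →
  trans (coeff-scale c (scale d p) n) (trans (cong (c ·_) (coeff-scale d p n))
    (trans (sym (ZP.*-assoc c d _)) (sym (coeff-scale (c · d) p n))))

scale-1 : ∀ p → scale 1ℤ p ≋ p
scale-1 p = mk≋ λ n → trans (coeff-scale 1ℤ p n) (ZP.*-identityˡ _)

infixl 6 _-ₚ_
_-ₚ_ : Poly → Poly → Poly
p -ₚ q = p +ₚ scale (- 1ℤ) q

coeff--ₚ : ∀ p q n → coeff (p -ₚ q) n ≡ coeff p n - coeff q n
coeff--ₚ p q n =
  trans (coeff-+ₚ p (scale (- 1ℤ) q) n) (cong (λ z → coeff p n + z) (trans (coeff-scale (- 1ℤ) q n) (ZP.-1*i≡-i _)))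

-ₚ≋[]⇒≋ : ∀ p q → p -ₚ q ≋ [] → p ≋ q
-ₚ≋[]⇒≋ p q h = mk≋ λ n → ZP.i-j≡0⇒i≡j (coeff p n) (coeff q n) (trans (sym (coeff--ₚ p q n)) (at h n))

≋⇒-ₚ≋[] : ∀ p q → p ≋ q → p -ₚ q ≋ []
≋⇒-ₚ≋[] p q h = mk≋ λ n → trans (coeff--ₚ p q n) (ZP.i≡j⇒i-j≡0 (at h n))

*ₚ-distribˡ--ₚ : ∀ p q q' → p *ₚ (q -ₚ q') ≋ p *ₚ q -ₚ p *ₚ q'
*ₚ-distribˡ--ₚ p q q' = ≋-trans (*ₚ-distribˡ-+ₚ p q (scale (- 1ℤ) q')) (+ₚ-cong ≋-refl (scale-*ₚʳ (- 1ℤ) p q'))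

-ₚ-cong : ∀ {p p' q q'} → p ≋ p' → q ≋ q' → p -ₚ q ≋ p' -ₚ q'
-ₚ-cong p≋p' q≋q' = +ₚ-cong p≋p' (scale-cong q≋q')

*ₚ-distribʳ--ₚ : ∀ p q r → (p -ₚ q) *ₚ r ≋ p *ₚ r -ₚ q *ₚ r
*ₚ-distribʳ--ₚ p q r = ≋-trans (*ₚ-distribʳ-+ₚ p (scale (- 1ℤ) q) r) (+ₚ-cong ≋-refl (scale-*ₚˡ (- 1ℤ) q r))

Deg≤0⇒tail≋[] : ∀ a p → Deg≤ (a ∷ p) 0 → p ≋ []
Deg≤0⇒tail≋[] a p b = mk≋ λ j → b (suc j) (s≤s z≤n)

Deg≤-tail : ∀ a p n → Deg≤ (a ∷ p) (suc n) → Deg≤ p n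
Deg≤-tail a p n b k h = b (suc k) (s≤s h)

Deg≤-*ₚ : ∀ p n q m → Deg≤ p n → Deg≤ q m →
  Deg≤ (p *ₚ q) (n +ℕ m) × coeff (p *ₚ q) (n +ℕ m) ≡ coeff p n · coeff q m
Deg≤-*ₚ [] n q m p≤n q≤m = (λ k _ → refl) , sym (ZP.*-zeroˡ (coeff q m))
Deg≤-*ₚ (a ∷ p) zero q m p≤0 q≤m = bound , trans (coeff-a∷p*q m) (ZP.+-identityʳ _)
  where
  coeff-a∷p*q : ∀ k → coeff ((a ∷ p) *ₚ q) k ≡ a · coeff q k + 0ℤ
  coeff-a∷p*q zero = coeff-∷-*ₚ a p q 0
  coeff-a∷p*q (suc k) = trans (coeff-∷-*ₚ a p q (suc k))
    (cong (λ w → a · coeff q (suc k) + w) (at (*ₚ-congʳ q (Deg≤0⇒tail≋[] a p p≤0)) k))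
  bound : Deg≤ ((a ∷ p) *ₚ q) m
  bound k m<k = trans (coeff-a∷p*q k) (trans (cong (λ w → a · w + 0ℤ) (q≤m k m<k)) (cong (_+ 0ℤ) (ZP.*-zeroʳ a)))
Deg≤-*ₚ (a ∷ p) (suc n) q m a∷p≤1+n q≤m = bound , top
  where
  p*q = Deg≤-*ₚ p n q m (Deg≤-tail a p n a∷p≤1+n) q≤m
  a·q≡0 : ∀ k → n +ℕ m < k → a · coeff q (suc k) ≡ 0ℤ
  a·q≡0 k n+m<k = trans (cong (a ·_) (q≤m (suc k) (s≤s (NP.≤-trans (NP.m≤n+m m n) (NP.<⇒≤ n+m<k))))) (ZP.*-zeroʳ a)
  bound : Deg≤ ((a ∷ p) *ₚ q) (suc n +ℕ m)
  bound (suc k) (s≤s n+m<k) =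
    trans (coeff-∷-*ₚ a p q (suc k)) (cong₂ _+_ (a·q≡0 k n+m<k) (proj₁ p*q k n+m<k))
  top : coeff ((a ∷ p) *ₚ q) (suc (n +ℕ m)) ≡ coeff p n · coeff q m
  top = trans (coeff-∷-*ₚ a p q (suc (n +ℕ m)))
    (trans (cong₂ _+_ (trans (cong (a ·_) (q≤m (suc (n +ℕ m)) (s≤s (NP.m≤n+m m n)))) (ZP.*-zeroʳ a)) (proj₂ p*q))
      (ZP.+-identityˡ _))

deg-cong : ∀ {p q} → p ≋ q → deg p ≡ deg q
deg-cong {p} {q} h = cong (λ l → length l ∸ 1) (≋⇒≈ p q h)

lead-cong : ∀ {p q} → p ≋ q → lead p ≡ lead q
lead-cong {p} {q} h = cong lastOr0 (≋⇒≈ p q h)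

lead≢0⇒NonZeroₚ : ∀ p → lead p ≢ 0ℤ → NonZeroₚ p
lead≢0⇒NonZeroₚ p ne z = ne (lead-cong z)

*-≢0 : ∀ x y → x ≢ 0ℤ → y ≢ 0ℤ → x · y ≢ 0ℤ
*-≢0 x y nx ny e with ZP.i*j≡0⇒i≡0∨j≡0 x e
... | inj₁ a = nx a
... | inj₂ b = ny b

deg-*ₚ : ∀ p q → NonZeroₚ p → NonZeroₚ q → deg (p *ₚ q) ≡ deg p +ℕ deg q
deg-*ₚ p q p≉0 q≉0 = deg-unique (p *ₚ q) _ (proj₁ pq) λ top≡0 →
  *-≢0 _ _ (lead≢0 p p≉0) (lead≢0 q q≉0) (trans (sym (cong₂ _·_ (coeff-deg p) (coeff-deg q))) (trans (sym (proj₂ pq)) top≡0))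
  where pq = Deg≤-*ₚ p (deg p) q (deg q) (Deg≤-deg p) (Deg≤-deg q)

lead-*ₚ : ∀ p q → NonZeroₚ p → NonZeroₚ q → lead (p *ₚ q) ≡ lead p · lead q
lead-*ₚ p q p≉0 q≉0 = trans (sym (coeff-deg (p *ₚ q)))
  (trans (cong (coeff (p *ₚ q)) (deg-*ₚ p q p≉0 q≉0)) (trans (proj₂ pq) (cong₂ _·_ (coeff-deg p) (coeff-deg q))))
  where pq = Deg≤-*ₚ p (deg p) q (deg q) (Deg≤-deg p) (Deg≤-deg q)

NonZeroₚ-*ₚ : ∀ p q → NonZeroₚ p → NonZeroₚ q → NonZeroₚ (p *ₚ q)
NonZeroₚ-*ₚ p q p≉0 q≉0 = lead≢0⇒NonZeroₚ (p *ₚ q) λ lead≡0 →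
  *-≢0 _ _ (lead≢0 p p≉0) (lead≢0 q q≉0) (trans (sym (lead-*ₚ p q p≉0 q≉0)) lead≡0)

_≋?_ : ∀ p q → Dec (p ≋ q)
p ≋? q with LP.≡-dec ZP._≟_ (trim p) (trim q)
... | yes e = yes (≈⇒≋ e)
... | no ne = no λ h → ne (≋⇒≈ p q h)

≋[]? : ∀ p → Dec (p ≋ [])
≋[]? p = p ≋? []

*ₚ-cancelˡ : ∀ D X Y → NonZeroₚ D → D *ₚ X ≋ D *ₚ Y → X ≋ Y
*ₚ-cancelˡ D X Y nd h with ≋[]? (X -ₚ Y)
... | yes z = -ₚ≋[]⇒≋ X Y z
... | no nz = ⊥-elim (NonZeroₚ-*ₚ D (X -ₚ Y) nd nz (≋-trans (*ₚ-distribˡ--ₚ D X Y) (≋⇒-ₚ≋[] _ _ h)))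

deg-scale : ∀ c p → c ≢ 0ℤ → NonZeroₚ p → deg (scale c p) ≡ deg p
deg-scale c p nc np = deg-unique (scale c p) (deg p) (λ k h → trans (coeff-scale c p k) (trans (cong (c ·_) (Deg≤-deg p k h)) (ZP.*-zeroʳ c)))
  (λ e → *-≢0 c (lead p) nc (lead≢0 p np) (trans (cong (c ·_) (sym (coeff-deg p))) (trans (sym (coeff-scale c p (deg p))) e)))

Deg≤0⇒constant : ∀ p → Deg≤ p 0 → p ≋ (coeff p 0 ∷ [])
Deg≤0⇒constant p b = mk≋ λ { zero → refl ; (suc k) → b (suc k) (s≤s z≤n) }

deg≡0⇒constant : ∀ p → deg p ≡ 0 → p ≋ (coeff p 0 ∷ [])
deg≡0⇒constant p e = Deg≤0⇒constant p (subst (Deg≤ p) e (Deg≤-deg p))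

Sign : ℤ → Set
Sign u = u ≡ 1ℤ ⊎ u ≡ - 1ℤ

∣i∣≡1⇒Sign : ∀ x → ℤ.∣ x ∣ ≡ 1 → Sign x
∣i∣≡1⇒Sign (+ .1) refl = inj₁ refl
∣i∣≡1⇒Sign -[1+ zero ] refl = inj₂ refl

i*j≡1⇒Sign : ∀ x y → x · y ≡ 1ℤ → Sign x
i*j≡1⇒Sign x y e = ∣i∣≡1⇒Sign x (NP.m*n≡1⇒m≡1 _ _ (trans (sym (ZP.abs-* x y)) (cong ℤ.∣_∣ e)))

Sign⇒i*i≡1 : ∀ u → Sign u → u · u ≡ 1ℤ
Sign⇒i*i≡1 .(+ 1) (inj₁ refl) = refl
Sign⇒i*i≡1 .(- 1ℤ) (inj₂ refl) = refl

Sign⇒≢0 : ∀ u → Sign u → u ≢ 0ℤ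
Sign⇒≢0 .(+ 1) (inj₁ refl) ()
Sign⇒≢0 .(- 1ℤ) (inj₂ refl) ()

1ₚ≉[] : ¬ (1ₚ ≋ [])
1ₚ≉[] h with at h 0
... | ()

IsUnit⇒deg≡0 : ∀ p → IsUnit p → deg p ≡ 0
IsUnit⇒deg≡0 p (q , pq≈1) with ≋[]? p | ≋[]? q
... | yes p≋0 | _ = ⊥-elim (1ₚ≉[] (≋-trans (≋-sym (≈⇒≋ {p *ₚ q} {1ₚ} pq≈1)) (*ₚ-congʳ q p≋0)))
... | no _ | yes q≋0 =
  ⊥-elim (1ₚ≉[] (≋-trans (≋-sym (≈⇒≋ {p *ₚ q} {1ₚ} pq≈1)) (≋-trans (*ₚ-congˡ p q≋0) (*ₚ-zeroʳ p))))
... | no p≉0 | no q≉0 = NP.m+n≡0⇒m≡0 (deg p) (trans (sym (deg-*ₚ p q p≉0 q≉0)) (deg-cong (≈⇒≋ {p *ₚ q} {1ₚ} pq≈1)))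

Sign⇒IsUnit : ∀ u → Sign u → IsUnit (u ∷ [])
Sign⇒IsUnit u u± = (u ∷ []) , ≋⇒≈ ((u ∷ []) *ₚ (u ∷ [])) 1ₚ
  (≋-trans ([c]-*ₚ u (u ∷ [])) (mk≋ λ { zero → Sign⇒i*i≡1 u u± ; (suc n) → refl }))

scale-Sign-involutive : ∀ {c} → Sign c → ∀ X → scale c (scale c X) ≋ X
scale-Sign-involutive {c} c± X =
  ≋-trans (scale-scale c c X) (≋-trans (≋-reflexive (cong (λ u → scale u X) (Sign⇒i*i≡1 c c±))) (scale-1 X))

-- T^n · x(1/T) when x has degree at most n; coefficients of x beyond T^n are ignored.
revAt : ℕ → Poly → Poly
revAt zero x = coeff x 0 ∷ []
revAt (suc n) x = coeff x (suc n) ∷ revAt n x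

coeff-revAt-≤ : ∀ n x k → k ≤ n → coeff (revAt n x) k ≡ coeff x (n ∸ k)
coeff-revAt-≤ zero x zero z≤n = refl
coeff-revAt-≤ (suc n) x zero _ = refl
coeff-revAt-≤ (suc n) x (suc k) (s≤s h) = coeff-revAt-≤ n x k h

coeff-revAt-> : ∀ n x k → n < k → coeff (revAt n x) k ≡ 0ℤ
coeff-revAt-> zero x (suc k) _ = refl
coeff-revAt-> (suc n) x (suc k) (s≤s h) = coeff-revAt-> n x k h

revAt-cong : ∀ n {x y} → x ≋ y → revAt n x ≡ revAt n y
revAt-cong zero h = cong (_∷ []) (at h 0)
revAt-cong (suc n) h = cong₂ _∷_ (at h (suc n)) (revAt-cong n h)

Deg≤-revAt : ∀ n x → Deg≤ (revAt n x) n
Deg≤-revAt n x k h = coeff-revAt-> n x k h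

coeff-revAt-top : ∀ n x → coeff (revAt n x) n ≡ coeff x 0
coeff-revAt-top n x = trans (coeff-revAt-≤ n x n NP.≤-refl) (cong (coeff x) (NP.n∸n≡0 n))

coeff-revAt-0 : ∀ n x → coeff (revAt n x) 0 ≡ coeff x n
coeff-revAt-0 zero x = refl
coeff-revAt-0 (suc n) x = refl

Deg≤-ext : ∀ n P Q → (∀ k → k ≤ n → coeff P k ≡ coeff Q k) → Deg≤ P n → Deg≤ Q n → P ≋ Q
Deg≤-ext n P Q low P≤n Q≤n = mk≋ coeff-≡
  where
  coeff-≡ : ∀ k → coeff P k ≡ coeff Q k
  coeff-≡ k with k N.≤? n
  ... | yes k≤n = low k k≤n
  ... | no k≰n = trans (P≤n k (NP.≰⇒> k≰n)) (sym (Q≤n k (NP.≰⇒> k≰n)))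

revAt-involutive : ∀ n x → Deg≤ x n → revAt n (revAt n x) ≋ x
revAt-involutive n x x≤n = Deg≤-ext n _ x
  (λ k k≤n → trans (coeff-revAt-≤ n (revAt n x) k k≤n)
               (trans (coeff-revAt-≤ n x (n ∸ k) (NP.m∸n≤m n k)) (cong (coeff x) (NP.m∸[m∸n]≡n k≤n))))
  (Deg≤-revAt n _) x≤n

revAt-+ₚ : ∀ n p q → revAt n (p +ₚ q) ≋ revAt n p +ₚ revAt n q
revAt-+ₚ n p q = Deg≤-ext n _ _
  (λ k k≤n → trans (coeff-revAt-≤ n _ k k≤n) (trans (coeff-+ₚ p q (n ∸ k))
    (sym (trans (coeff-+ₚ (revAt n p) (revAt n q) k) (cong₂ _+_ (coeff-revAt-≤ n p k k≤n) (coeff-revAt-≤ n q k k≤n))))))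
  (Deg≤-revAt n _) (λ k h → trans (coeff-+ₚ (revAt n p) (revAt n q) k) (cong₂ _+_ (Deg≤-revAt n p k h) (Deg≤-revAt n q k h)))

revAt-scale : ∀ n c p → revAt n (scale c p) ≋ scale c (revAt n p)
revAt-scale n c p = Deg≤-ext n _ _
  (λ k k≤n → trans (coeff-revAt-≤ n _ k k≤n) (trans (coeff-scale c p (n ∸ k))
    (sym (trans (coeff-scale c (revAt n p) k) (cong (c ·_) (coeff-revAt-≤ n p k k≤n))))))
  (Deg≤-revAt n _) (λ k h → trans (coeff-scale c (revAt n p) k) (trans (cong (c ·_) (Deg≤-revAt n p k h)) (ZP.*-zeroʳ c)))

revAt-[] : ∀ n → revAt n [] ≋ []
revAt-[] n = mk≋ (coeff-revAt-[] n)
  where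
  coeff-revAt-[] : ∀ n k → coeff (revAt n []) k ≡ 0ℤ
  coeff-revAt-[] zero zero = refl
  coeff-revAt-[] zero (suc k) = refl
  coeff-revAt-[] (suc n) zero = refl
  coeff-revAt-[] (suc n) (suc k) = coeff-revAt-[] n k

shift : ℕ → Poly → Poly
shift zero X = X
shift (suc j) X = 0ℤ ∷ shift j X

shift-cong : ∀ j {X Y} → X ≋ Y → shift j X ≋ shift j Y
shift-cong zero h = h
shift-cong (suc j) h = ∷-cong refl (shift-cong j h)

shift-*ₚ : ∀ j X S → shift j X *ₚ S ≋ shift j (X *ₚ S)
shift-*ₚ zero X S = ≋-refl
shift-*ₚ (suc j) X S = ≋-trans (0∷-*ₚ (shift j X) S) (∷-cong refl (shift-*ₚ j X S))

shift-scale : ∀ j c X → shift j (scale c X) ≋ scale c (shift j X)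
shift-scale zero c X = ≋-refl
shift-scale (suc j) c X = ∷-cong (sym (ZP.*-zeroʳ c)) (shift-scale j c X)

coeff-shift-+ : ∀ j X i → coeff (shift j X) (j +ℕ i) ≡ coeff X i
coeff-shift-+ zero X i = refl
coeff-shift-+ (suc j) X i = coeff-shift-+ j X i

revAt-raise : ∀ j m q → Deg≤ q m → revAt (j +ℕ m) q ≋ shift j (revAt m q)
revAt-raise zero m q b = ≋-refl
revAt-raise (suc j) m q b = ∷-cong (b (suc (j +ℕ m)) (s≤s (NP.m≤n+m m j))) (revAt-raise j m q b)

revAt-0∷ : ∀ N X → revAt (suc N) (0ℤ ∷ X) ≋ revAt N X
revAt-0∷ zero X = mk≋ λ { zero → refl ; (suc zero) → refl ; (suc (suc k)) → refl }
revAt-0∷ (suc N) X = ∷-cong refl (revAt-0∷ N X)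

revAt-∷ : ∀ n a p → revAt (suc n) (a ∷ p) ≋ shift (suc n) (a ∷ []) +ₚ revAt n p
revAt-∷ zero a p = mk≋ λ { zero → sym (ZP.+-identityˡ _) ; (suc zero) → refl ; (suc (suc k)) → refl }
revAt-∷ (suc n) a p = ≋-trans (∷-cong refl (revAt-∷ n a p)) (mk≋ λ { zero → sym (ZP.+-identityˡ _) ; (suc k) → refl })

revAt-*ₚ : ∀ p n q m → Deg≤ p n → Deg≤ q m → revAt (n +ℕ m) (p *ₚ q) ≋ revAt n p *ₚ revAt m q
revAt-*ₚ [] n q m _ _ = ≋-trans (revAt-[] (n +ℕ m)) (≋-sym (*ₚ-congʳ (revAt m q) (revAt-[] n)))
revAt-*ₚ (a ∷ p) zero q m a∷p≤0 q≤m =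
  ≋-trans (≋-reflexive (revAt-cong m a∷p*q≋aq)) (≋-trans (revAt-scale m a q) (≋-sym ([c]-*ₚ a (revAt m q))))
  where
  a∷p*q≋aq : (a ∷ p) *ₚ q ≋ scale a q
  a∷p*q≋aq = ≋-trans (*ₚ-congʳ q (∷-cong refl (Deg≤0⇒tail≋[] a p a∷p≤0))) ([c]-*ₚ a q)
revAt-*ₚ (a ∷ p) (suc n) q m a∷p≤1+n q≤m = begin
  revAt (suc (n +ℕ m)) ((a ∷ p) *ₚ q)
    ≈⟨ revAt-+ₚ (suc (n +ℕ m)) (scale a q) (0ℤ ∷ (p *ₚ q)) ⟩
  revAt (suc (n +ℕ m)) (scale a q) +ₚ revAt (suc (n +ℕ m)) (0ℤ ∷ (p *ₚ q))
    ≈⟨ +ₚ-cong (≋-trans (revAt-scale (suc (n +ℕ m)) a q) (scale-cong (revAt-raise (suc n) m q q≤m)))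
               (≋-trans (revAt-0∷ (n +ℕ m) (p *ₚ q)) (revAt-*ₚ p n q m (Deg≤-tail a p n a∷p≤1+n) q≤m)) ⟩
  scale a (shift (suc n) (revAt m q)) +ₚ revAt n p *ₚ revAt m q
    ≈⟨ +ₚ-cong shifted-a*q ≋-refl ⟨
  shift (suc n) (a ∷ []) *ₚ revAt m q +ₚ revAt n p *ₚ revAt m q
    ≈⟨ *ₚ-distribʳ-+ₚ (shift (suc n) (a ∷ [])) (revAt n p) (revAt m q) ⟨
  (shift (suc n) (a ∷ []) +ₚ revAt n p) *ₚ revAt m q
    ≈⟨ *ₚ-congʳ (revAt m q) (revAt-∷ n a p) ⟨
  revAt (suc n) (a ∷ p) *ₚ revAt m q ∎
  where
  open ≋-Reasoning
  shifted-a*q : shift (suc n) (a ∷ []) *ₚ revAt m q ≋ scale a (shift (suc n) (revAt m q))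
  shifted-a*q = ≋-trans (shift-*ₚ (suc n) (a ∷ []) (revAt m q))
    (≋-trans (shift-cong (suc n) ([c]-*ₚ a (revAt m q))) (shift-scale (suc n) a (revAt m q)))

revAt-snoc : ∀ n a l → revAt (suc n) (a ∷ l) ≡ revAt n l ++ (a ∷ [])
revAt-snoc zero a l = refl
revAt-snoc (suc n) a l = cong (coeff l (suc n) ∷_) (revAt-snoc n a l)

revAt-length : ∀ a l → revAt (length l) (a ∷ l) ≡ reverse (a ∷ l)
revAt-length a [] = refl
revAt-length a (b ∷ l) = trans (revAt-snoc (length l) a (b ∷ l))
  (trans (cong (_++ (a ∷ [])) (revAt-length b l)) (sym (LP.unfold-reverse a (b ∷ l))))

reverse≋revAt : ∀ l → reverse l ≋ revAt (length l ∸ 1) l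
reverse≋revAt [] = mk≋ λ { zero → refl ; (suc k) → refl }
reverse≋revAt (a ∷ l) rewrite sym (revAt-length a l) = ≋-refl

rev≋revAt : ∀ p → rev p ≋ revAt (deg p) p
rev≋revAt p = ≋-trans (reverse≋revAt (trim p)) (≋-reflexive (revAt-cong (deg p) (mk≋ (coeff-trim p))))

eval : ℤ → Poly → ℤ
eval x [] = 0ℤ
eval x (a ∷ p) = a + x · eval x p

eval-smartCons : ∀ x a l → eval x (smartCons a l) ≡ a + x · eval x l
eval-smartCons x a (y ∷ l) = refl
eval-smartCons x (+ zero) [] = sym (trans (ZP.+-identityˡ _) (ZP.*-zeroʳ x))
eval-smartCons x (+ suc k) [] = refl
eval-smartCons x -[1+ k ] [] = refl

eval-trim : ∀ x p → eval x (trim p) ≡ eval x p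
eval-trim x [] = refl
eval-trim x (a ∷ p) rewrite trim-∷ a p = trans (eval-smartCons x a (trim p)) (cong (λ z → a + x · z) (eval-trim x p))

eval-cong : ∀ x {p q} → p ≋ q → eval x p ≡ eval x q
eval-cong x {p} {q} h = trans (sym (eval-trim x p)) (trans (cong (eval x) (≋⇒≈ p q h)) (eval-trim x q))

eval-+ₚ : ∀ x p q → eval x (p +ₚ q) ≡ eval x p + eval x q
eval-+ₚ x [] q = sym (ZP.+-identityˡ _)
eval-+ₚ x (a ∷ p) [] = sym (ZP.+-identityʳ _)
eval-+ₚ x (a ∷ p) (b ∷ q) rewrite eval-+ₚ x p q = regroup a b x (eval x p) (eval x q)
  where
  regroup : ∀ a b x u v → a + b + x · (u + v) ≡ a + x · u + (b + x · v)
  regroup = solve-∀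

eval-scale : ∀ x c p → eval x (scale c p) ≡ c · eval x p
eval-scale x c [] = sym (ZP.*-zeroʳ c)
eval-scale x c (a ∷ p) rewrite eval-scale x c p = factor-out c a x (eval x p)
  where
  factor-out : ∀ c a x u → c · a + x · (c · u) ≡ c · (a + x · u)
  factor-out = solve-∀

eval-*ₚ : ∀ x p q → eval x (p *ₚ q) ≡ eval x p · eval x q
eval-*ₚ x [] q = refl
eval-*ₚ x (a ∷ p) q rewrite eval-+ₚ x (scale a q) (0ℤ ∷ (p *ₚ q)) | eval-scale x a q | eval-*ₚ x p q
  = factor-out a x (eval x p) (eval x q)
  where
  factor-out : ∀ a x u v → a · v + (0ℤ + x · (u · v)) ≡ (a + x · u) · v
  factor-out = solve-∀

eval-shift : ∀ x j Y → eval x (shift j Y) ≡ x ^ j · eval x Y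
eval-shift x zero Y = sym (ZP.*-identityˡ _)
eval-shift x (suc j) Y rewrite eval-shift x j Y = trans (ZP.+-identityˡ _) (sym (ZP.*-assoc x (x ^ j) (eval x Y)))

eval-revAt : ∀ x → x · x ≡ 1ℤ → ∀ p n → Deg≤ p n → eval x (revAt n p) ≡ x ^ n · eval x p
eval-revAt x x²≡1 [] n _ = trans (eval-cong x (revAt-[] n)) (sym (ZP.*-zeroʳ (x ^ n)))
eval-revAt x x²≡1 (a ∷ p) zero a∷p≤0 = begin
  a + x · 0ℤ               ≡⟨ cong (λ z → a + x · z) (eval-cong x (Deg≤0⇒tail≋[] a p a∷p≤0)) ⟨
  a + x · eval x p         ≡⟨ ZP.*-identityˡ _ ⟨
  1ℤ · (a + x · eval x p)  ∎
  where open ≡-Reasoning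
eval-revAt x x²≡1 (a ∷ p) (suc n) a∷p≤1+n = begin
  eval x (revAt (suc n) (a ∷ p))                        ≡⟨ eval-cong x (revAt-∷ n a p) ⟩
  eval x (shift (suc n) (a ∷ []) +ₚ revAt n p)          ≡⟨ eval-+ₚ x (shift (suc n) (a ∷ [])) (revAt n p) ⟩
  eval x (shift (suc n) (a ∷ [])) + eval x (revAt n p)
    ≡⟨ cong₂ _+_ (eval-shift x (suc n) (a ∷ [])) (eval-revAt x x²≡1 p n (Deg≤-tail a p n a∷p≤1+n)) ⟩
  x · x ^ n · (a + x · 0ℤ) + x ^ n · eval x p
    ≡⟨ cong (λ u → x · x ^ n · (a + x · 0ℤ) + u · eval x p) (trans (cong (_· x ^ n) x²≡1) (ZP.*-identityˡ (x ^ n))) ⟨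
  x · x ^ n · (a + x · 0ℤ) + x · x · x ^ n · eval x p  ≡⟨ expand x a (x ^ n) (eval x p) ⟩
  x · x ^ n · (a + x · eval x p)                        ∎
  where
  open ≡-Reasoning
  expand : ∀ x a w e → x · w · (a + x · 0ℤ) + x · x · w · e ≡ x · w · (a + x · e)
  expand = solve-∀

-1^even≡1 : ∀ k → (- 1ℤ) ^ (k +ℕ k) ≡ 1ℤ
-1^even≡1 zero = refl
-1^even≡1 (suc k) rewrite NP.+-suc k k | -1^even≡1 k = refl

-1^odd≡-1 : ∀ k → (- 1ℤ) ^ (suc (k +ℕ k)) ≡ - 1ℤ
-1^odd≡-1 k rewrite -1^even≡1 k = refl

even⊎odd : ∀ n → Even n ⊎ (Σ ℕ λ k → n ≡ suc (k +ℕ k))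
even⊎odd zero = inj₁ (0 , refl)
even⊎odd (suc n) with even⊎odd n
... | inj₁ (k , e) = inj₂ (k , cong suc e)
... | inj₂ (k , e) = inj₁ (suc k , trans (cong suc e) (cong suc (sym (NP.+-suc k k))))

i≡-i⇒i≡0 : ∀ x → x ≡ - x → x ≡ 0ℤ
i≡-i⇒i≡0 (+ zero) e = refl
i≡-i⇒i≡0 (+ suc k) ()
i≡-i⇒i≡0 -[1+ k ] ()

Deg<-mono : ∀ {X m n} → Deg< X m → m ≤ n → Deg< X n
Deg<-mono X<m m≤n k n≤k = X<m k (NP.≤-trans m≤n n≤k)

Deg≤-shift : ∀ j X {m} → Deg≤ X m → Deg≤ (shift j X) (j +ℕ m)
Deg≤-shift zero X X≤m = X≤m
Deg≤-shift (suc j) X X≤m (suc k) (s≤s j+m<k) = Deg≤-shift j X X≤m k j+m<k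

*ₚ-shift-1ₚ : ∀ D j → D *ₚ shift j 1ₚ ≋ shift j D
*ₚ-shift-1ₚ D j = ≋-trans (*ₚ-comm D (shift j 1ₚ)) (≋-trans (shift-*ₚ j 1ₚ D) (shift-cong j (*ₚ-identityˡ D)))

scale-+ₚ : ∀ c p q → scale c (p +ₚ q) ≋ scale c p +ₚ scale c q
scale-+ₚ c p q = mk≋ λ n → trans (coeff-scale c (p +ₚ q) n) (trans (cong (c ·_) (coeff-+ₚ p q n))
  (trans (ZP.*-distribˡ-+ c _ _) (sym (trans (coeff-+ₚ (scale c p) (scale c q) n) (cong₂ _+_ (coeff-scale c p n) (coeff-scale c q n))))))

+ₚ-assoc : ∀ p q r → (p +ₚ q) +ₚ r ≋ p +ₚ (q +ₚ r)
+ₚ-assoc p q r = mk≋ λ n → begin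
  coeff ((p +ₚ q) +ₚ r) n           ≡⟨ coeff-+ₚ (p +ₚ q) r n ⟩
  coeff (p +ₚ q) n + coeff r n      ≡⟨ cong (_+ coeff r n) (coeff-+ₚ p q n) ⟩
  coeff p n + coeff q n + coeff r n ≡⟨ ZP.+-assoc (coeff p n) (coeff q n) (coeff r n) ⟩
  coeff p n + (coeff q n + coeff r n) ≡⟨ cong (λ z → coeff p n + z) (coeff-+ₚ q r n) ⟨
  coeff p n + coeff (q +ₚ r) n      ≡⟨ coeff-+ₚ p (q +ₚ r) n ⟨
  coeff (p +ₚ (q +ₚ r)) n           ∎
  where open ≡-Reasoning

+ₚ--ₚ-cancel : ∀ p q → p +ₚ (q -ₚ p) ≋ q
+ₚ--ₚ-cancel p q = mk≋ λ n →
  trans (coeff-+ₚ p (q -ₚ p) n) (trans (cong (λ z → coeff p n + z) (coeff--ₚ q p n)) (i+[j-i]≡j (coeff p n) (coeff q n)))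
  where
  i+[j-i]≡j : ∀ i j → i + (j - i) ≡ j
  i+[j-i]≡j = solve-∀

≋+ₚ⇒≋-ₚ : ∀ {X} P R → X ≋ P +ₚ R → R ≋ X -ₚ P
≋+ₚ⇒≋-ₚ {X} P R X≋P+R = mk≋ λ k → sym (trans (coeff--ₚ X P k)
  (trans (cong (_- coeff P k) (trans (at X≋P+R k) (coeff-+ₚ P R k))) (i+j-i≡j (coeff P k) (coeff R k))))

longDivisionStep : ∀ D e → Deg≤ D e → ∀ n X → Deg< X (suc n) → e ≤ n →
  Σ Poly λ X' → (scale (coeff D e) X ≋ D *ₚ scale (coeff X n) (shift (n ∸ e) 1ₚ) +ₚ X') × Deg< X' n
longDivisionStep D e D≤e n X X≤n e≤n = X' , equation , X'<n
  where
  c = coeff D e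
  xₙ = coeff X n
  j = n ∸ e
  j+e≡n : j +ℕ e ≡ n
  j+e≡n = NP.m∸n+n≡m e≤n
  S = shift j D
  S≤n : Deg≤ S n
  S≤n = subst (Deg≤ S) j+e≡n (Deg≤-shift j D D≤e)
  S-top : coeff S n ≡ c
  S-top = subst (λ k → coeff S k ≡ c) j+e≡n (coeff-shift-+ j D e)
  X' = scale c X -ₚ scale xₙ S
  coeff-X' : ∀ k → coeff X' k ≡ c · coeff X k - xₙ · coeff S k
  coeff-X' k = trans (coeff--ₚ (scale c X) (scale xₙ S) k) (cong₂ _-_ (coeff-scale c X k) (coeff-scale xₙ S k))
  X'<n : Deg< X' n
  X'<n k n≤k with NP.m≤n⇒m<n∨m≡n n≤k
  ... | inj₂ refl = trans (coeff-X' n) (trans (cong (λ s → c · xₙ - xₙ · s) S-top) (ZP.i≡j⇒i-j≡0 (ZP.*-comm c xₙ)))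
  ... | inj₁ n<k = trans (coeff-X' k)
          (trans (cong₂ (λ a b → c · a - xₙ · b) (X≤n k n<k) (S≤n k n<k)) (cong₂ _-_ (ZP.*-zeroʳ c) (ZP.*-zeroʳ xₙ)))
  equation : scale c X ≋ D *ₚ scale xₙ (shift j 1ₚ) +ₚ X'
  equation = begin
    scale c X                          ≈⟨ +ₚ--ₚ-cancel (scale xₙ S) (scale c X) ⟨
    scale xₙ S +ₚ X'                   ≈⟨ +ₚ-cong (≋-trans (scale-*ₚʳ xₙ D (shift j 1ₚ)) (scale-cong (*ₚ-shift-1ₚ D j))) ≋-refl ⟨
    D *ₚ scale xₙ (shift j 1ₚ) +ₚ X'   ∎
    where open ≋-Reasoning

PseudoDivision : Poly → ℤ → Poly → ℕ → Set
PseudoDivision D c X e = Σ ℕ λ N → Σ Poly λ Q → Σ Poly λ R → (scale (c ^ N) X ≋ D *ₚ Q +ₚ R) × Deg< R e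

pseudoDivide : ∀ D e → Deg≤ D e → ∀ n X → Deg< X n → PseudoDivision D (coeff D e) X e
pseudoDivide D e D≤e n X X<n with n N.≤? e
... | yes n≤e = 0 , [] , X , X≋D*[]+X , Deg<-mono {X} X<n n≤e
  where
  X≋D*[]+X : scale 1ℤ X ≋ D *ₚ [] +ₚ X
  X≋D*[]+X = ≋-trans (scale-1 X) (≋-sym (+ₚ-cong (*ₚ-zeroʳ D) ≋-refl))
pseudoDivide D e D≤e zero X X<0 | no 0≰e = ⊥-elim (0≰e z≤n)
pseudoDivide D e D≤e (suc n) X X≤n | no 1+n≰e with longDivisionStep D e D≤e n X X≤n (NP.≤-pred (NP.≰⇒> 1+n≰e))
... | X' , cX≋DS+X' , X'<n with pseudoDivide D e D≤e n X' X'<n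
...   | N , Q , R , cᴺX'≋DQ+R , R<e = suc N , Q +ₚ scale (c ^ N) S , R , equation , R<e
  where
  open ≋-Reasoning
  c = coeff D e
  S = scale (coeff X n) (shift (n ∸ e) 1ₚ)
  equation : scale (c ^ suc N) X ≋ D *ₚ (Q +ₚ scale (c ^ N) S) +ₚ R
  equation = begin
    scale (c · c ^ N) X                        ≡⟨ cong (λ u → scale u X) (ZP.*-comm c (c ^ N)) ⟩
    scale (c ^ N · c) X                        ≈⟨ scale-scale (c ^ N) c X ⟨
    scale (c ^ N) (scale c X)                  ≈⟨ scale-cong cX≋DS+X' ⟩
    scale (c ^ N) (D *ₚ S +ₚ X')               ≈⟨ scale-+ₚ (c ^ N) (D *ₚ S) X' ⟩
    scale (c ^ N) (D *ₚ S) +ₚ scale (c ^ N) X' ≈⟨ +ₚ-cong (≋-sym (scale-*ₚʳ (c ^ N) D S)) cᴺX'≋DQ+R ⟩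
    D *ₚ scale (c ^ N) S +ₚ (D *ₚ Q +ₚ R)      ≈⟨ +ₚ-assoc (D *ₚ scale (c ^ N) S) (D *ₚ Q) R ⟨
    D *ₚ scale (c ^ N) S +ₚ D *ₚ Q +ₚ R        ≈⟨ +ₚ-cong (+ₚ-comm (D *ₚ scale (c ^ N) S) (D *ₚ Q)) ≋-refl ⟩
    D *ₚ Q +ₚ D *ₚ scale (c ^ N) S +ₚ R        ≈⟨ +ₚ-cong (*ₚ-distribˡ-+ₚ D Q (scale (c ^ N) S)) ≋-refl ⟨
    D *ₚ (Q +ₚ scale (c ^ N) S) +ₚ R           ∎

small-multiple≋[] : ∀ D R Q → NonZeroₚ D → Deg< R (deg D) → R ≋ D *ₚ Q → R ≋ []
small-multiple≋[] D R Q D≉0 R<degD R≋DQ with ≋[]? Q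
... | yes Q≋0 = ≋-trans R≋DQ (≋-trans (*ₚ-congˡ D Q≋0) (*ₚ-zeroʳ D))
... | no Q≉0 = ⊥-elim (lead≢0 (D *ₚ Q) (NonZeroₚ-*ₚ D Q D≉0 Q≉0)
        (trans (sym (coeff-deg (D *ₚ Q))) (trans (sym (at R≋DQ _))
          (R<degD _ (subst (deg D ≤_) (sym (deg-*ₚ D Q D≉0 Q≉0)) (NP.m≤m+n _ _))))))

infix 4 _∣_
_∣_ : Poly → Poly → Set
D ∣ X = Σ Poly λ Q → X ≋ D *ₚ Q

record MonicOfDegree (P : Poly) (d : ℕ) : Set where
  constructor mk-monic
  field
    bounded : Deg≤ P d
    leading : coeff P d ≡ 1ℤ
open MonicOfDegree public

MonicOfDegree⇒NonZeroₚ : ∀ D d → MonicOfDegree D d → NonZeroₚ D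
MonicOfDegree⇒NonZeroₚ D d (mk-monic _ top) D≋0 with trans (sym top) (at D≋0 d)
... | ()

MonicOfDegree⇒deg : ∀ D d → MonicOfDegree D d → deg D ≡ d
MonicOfDegree⇒deg D d (mk-monic D≤d top) = deg-unique D d D≤d (λ e → Sign⇒≢0 _ (inj₁ refl) (trans (sym top) e))

scale-monic : ∀ c P {d} → Deg≤ P d → c · coeff P d ≡ 1ℤ → MonicOfDegree (scale c P) d
scale-monic c P {d} P≤d top = mk-monic
  (λ k d<k → trans (coeff-scale c P k) (trans (cong (c ·_) (P≤d k d<k)) (ZP.*-zeroʳ c)))
  (trans (coeff-scale c P d) top)

monicOfDegree : ∀ g e → deg g ≡ e → lead g ≡ 1ℤ → MonicOfDegree g e
monicOfDegree g e deg≡e lead≡1 =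
  mk-monic (subst (Deg≤ g) deg≡e (Deg≤-deg g)) (trans (cong (coeff g) (sym deg≡e)) (trans (coeff-deg g) lead≡1))

MonicOfDegree⇒lead : ∀ g e → MonicOfDegree g e → lead g ≡ 1ℤ
MonicOfDegree⇒lead g e mg = trans (sym (coeff-deg g)) (trans (cong (coeff g) (MonicOfDegree⇒deg g e mg)) (leading mg))

∣-refl : ∀ X → X ∣ X
∣-refl X = 1ₚ , ≋-sym (≋-trans (*ₚ-comm X 1ₚ) (*ₚ-identityˡ X))

∣-trans : ∀ {A B C} → A ∣ B → B ∣ C → A ∣ C
∣-trans {A} (Q , B≋AQ) (Q' , C≋BQ') = Q *ₚ Q' , ≋-trans C≋BQ' (≋-trans (*ₚ-congʳ Q' B≋AQ) (*ₚ-assoc A Q Q'))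

divideByMonic : ∀ D d → MonicOfDegree D d → ∀ X → Σ Poly λ Q → Σ Poly λ R → (X ≋ D *ₚ Q +ₚ R) × Deg< R d
divideByMonic D d (mk-monic D≤d top) X with pseudoDivide D d D≤d (suc (deg X)) X (Deg≤-deg X)
... | N , Q , R , X≋DQ+R , R<d = Q , R , ≋-trans (≋-sym 1ᴺX≋X) X≋DQ+R , R<d
  where
  1ᴺX≋X : scale (coeff D d ^ N) X ≋ X
  1ᴺX≋X = ≋-trans (≋-reflexive (cong (λ c → scale (c ^ N) X) top))
            (≋-trans (≋-reflexive (cong (λ u → scale u X) (ZP.^-zeroˡ N))) (scale-1 X))

monic-∣? : ∀ D d → MonicOfDegree D d → ∀ X → Dec (D ∣ X)
monic-∣? D d mD X with divideByMonic D d mD X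
... | Q , R , X≋DQ+R , R<d with ≋[]? R
...   | yes R≋0 = yes (Q , ≋-trans X≋DQ+R (≋-trans (+ₚ-cong ≋-refl R≋0) (+ₚ-identityʳ _)))
...   | no R≉0 = no λ { (Q' , X≋DQ') → R≉0 (small-multiple≋[] D R (Q' -ₚ Q) (MonicOfDegree⇒NonZeroₚ D d mD)
          (subst (Deg< R) (sym (MonicOfDegree⇒deg D d mD)) R<d)
          (≋-trans (≋+ₚ⇒≋-ₚ (D *ₚ Q) R X≋DQ+R)
            (≋-trans (+ₚ-cong X≋DQ' ≋-refl) (≋-sym (*ₚ-distribˡ--ₚ D Q' Q))))) }

-- Gauss's lemma

primeDivisor : ∀ n → 1 < n → Σ ℕ λ p → Prime p × p ND.∣ n
primeDivisor n@(suc _) 1<n with factorise n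
... | record { factors = [] ; isFactorisation = n≡1 } = ⊥-elim (NP.<-irrefl (sym n≡1) 1<n)
... | record { factors = p ∷ ps ; isFactorisation = n≡p·ps ; factorsPrime = p-prime ∷ _ } =
  p , p-prime , ND.divides (product ps) (trans n≡p·ps (NP.*-comm p _))

prime⇒>1 : ∀ {p} → Prime p → 1 < p
prime⇒>1 {p} p-prime = N.nonTrivial⇒n>1 p {{prime⇒nonTrivial p-prime}}

prime⇒+p≢0 : ∀ {p} → Prime p → + p ≢ 0ℤ
prime⇒+p≢0 p-prime with prime⇒>1 p-prime
... | s≤s (s≤s _) = λ ()

AllDivisible : ℕ → Poly → Set
AllDivisible p Y = ∀ n → (+ p) DS.∣ coeff Y n

∣0ℤ : ∀ k → k DS.∣ 0ℤ
∣0ℤ k = DS.divides 0ℤ (sym (ZP.*-zeroˡ k))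

euclidsLemmaℤ : ∀ {p} → Prime p → ∀ x y → (+ p) DS.∣ x · y → (+ p) DS.∣ x ⊎ (+ p) DS.∣ y
euclidsLemmaℤ {p} p-prime x y p∣xy =
  Sum.map DS.∣ᵤ⇒∣ DS.∣ᵤ⇒∣ (euclidsLemma ℤ.∣ x ∣ ℤ.∣ y ∣ p-prime (subst (p ND.∣_) (ZP.abs-* x y) (DS.∣⇒∣ᵤ p∣xy)))

gauss-∷ : ∀ {p} → Prime p → ∀ a Y Z → ¬ (+ p) DS.∣ a → AllDivisible p ((a ∷ Y) *ₚ Z) → AllDivisible p Z
gauss-∷ p-prime a Y [] _ _ = λ _ → ∣0ℤ _
gauss-∷ {p} p-prime a Y (b ∷ Z) p∤a p∣prod with (+ p) DS.∣? b
... | yes p∣b = λ { zero → p∣b ; (suc n) → gauss-∷ p-prime a Y Z p∤a p∣a∷Y*Z n }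
  where
  peel : ∀ n → coeff ((a ∷ Y) *ₚ (b ∷ Z)) (suc n) - b · coeff Y n ≡ coeff ((a ∷ Y) *ₚ Z) n
  peel n = trans (cong (_- b · coeff Y n) (trans (at (*ₚ-∷ (a ∷ Y) b Z) (suc n))
             (trans (coeff-+ₚ (scale b (a ∷ Y)) (0ℤ ∷ ((a ∷ Y) *ₚ Z)) (suc n))
               (cong (_+ coeff ((a ∷ Y) *ₚ Z) n) (coeff-scale b Y n)))))
           (i+j-i≡j (b · coeff Y n) (coeff ((a ∷ Y) *ₚ Z) n))
  p∣a∷Y*Z : AllDivisible p ((a ∷ Y) *ₚ Z)
  p∣a∷Y*Z n = subst ((+ p) DS.∣_) (peel n) (DS.∣m∣n⇒∣m-n (p∣prod (suc n)) (DS.∣m⇒∣m*n (coeff Y n) p∣b))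
... | no p∤b with euclidsLemmaℤ p-prime a b (subst ((+ p) DS.∣_) (ZP.+-identityʳ (a · b)) (p∣prod 0))
...   | inj₁ p∣a = ⊥-elim (p∤a p∣a)
...   | inj₂ p∣b = ⊥-elim (p∤b p∣b)

gauss : ∀ {p} → Prime p → ∀ Y Z → AllDivisible p (Y *ₚ Z) → AllDivisible p Y ⊎ AllDivisible p Z
gauss p-prime [] Z _ = inj₁ (λ _ → ∣0ℤ _)
gauss {p} p-prime (a ∷ Y) Z p∣prod with (+ p) DS.∣? a
... | no p∤a = inj₂ (gauss-∷ p-prime a Y Z p∤a p∣prod)
... | yes p∣a = Sum.map₁ (λ p∣Y → λ { zero → p∣a ; (suc n) → p∣Y n }) (gauss p-prime Y Z p∣Y*Z)
  where
  p∣Y*Z : AllDivisible p (Y *ₚ Z)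
  p∣Y*Z n = subst ((+ p) DS.∣_)
    (trans (cong (_- a · coeff Z (suc n)) (coeff-∷-*ₚ a Y Z (suc n))) (i+j-i≡j (a · coeff Z (suc n)) (coeff (Y *ₚ Z) n)))
    (DS.∣m∣n⇒∣m-n (p∣prod (suc n)) (DS.∣m⇒∣m*n (coeff Z (suc n)) p∣a))

divideOut : ∀ p Y → AllDivisible p Y → Σ Poly λ Y' → Y ≋ scale (+ p) Y'
divideOut p [] _ = [] , ≋-refl
divideOut p (a ∷ Y) p∣a∷Y with divideOut p Y (λ n → p∣a∷Y (suc n))
... | Y' , Y≋pY' = DS._∣_.quotient (p∣a∷Y 0) ∷ Y' , ∷-cong (trans (DS._∣_.equality (p∣a∷Y 0)) (ZP.*-comm _ (+ p))) Y≋pY'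

scale-cancel : ∀ c {U V} → c ≢ 0ℤ → scale c U ≋ scale c V → U ≋ V
scale-cancel c {U} {V} c≢0 cU≋cV = mk≋ λ n →
  ZP.*-cancelˡ-≡ c (coeff U n) (coeff V n) {{ℤ.≢-nonZero c≢0}} (trans (sym (coeff-scale c U n)) (trans (at cU≋cV n) (coeff-scale c V n)))

i≢0⇒∣i∣≥1 : ∀ c → c ≢ 0ℤ → 1 ≤ ℤ.∣ c ∣
i≢0⇒∣i∣≥1 (+ zero) c≢0 = ⊥-elim (c≢0 refl)
i≢0⇒∣i∣≥1 (+ suc k) _ = s≤s z≤n
i≢0⇒∣i∣≥1 -[1+ k ] _ = s≤s z≤n

∣i∣≤1⇒Sign : ∀ c → c ≢ 0ℤ → ℤ.∣ c ∣ ≤ 1 → Sign c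
∣i∣≤1⇒Sign (+ zero) c≢0 _ = ⊥-elim (c≢0 refl)
∣i∣≤1⇒Sign (+ suc zero) _ _ = inj₁ refl
∣i∣≤1⇒Sign (+ suc (suc k)) _ (s≤s ())
∣i∣≤1⇒Sign -[1+ zero ] _ _ = inj₂ refl
∣i∣≤1⇒Sign -[1+ suc k ] _ (s≤s ())

record ConstantSplitting (X Y Z : Poly) : Set where
  constructor splitting
  field
    u a b : ℤ
    Y' Z' : Poly
    u-sign : Sign u
    a≢0 : a ≢ 0ℤ
    b≢0 : b ≢ 0ℤ
    Y≋aY' : Y ≋ scale a Y'
    Z≋bZ' : Z ≋ scale b Z'
    X≋uY'Z' : X ≋ scale u (Y' *ₚ Z')

splitting-Sign : ∀ {c X Y Z} → Sign c → scale c X ≋ Y *ₚ Z → ConstantSplitting X Y Z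
splitting-Sign {c} {X} {Y} {Z} c± cX≋YZ =
  splitting c 1ℤ 1ℤ Y Z c± (λ ()) (λ ()) (≋-sym (scale-1 Y)) (≋-sym (scale-1 Z))
    (≋-trans (≋-sym (scale-Sign-involutive c± X)) (scale-cong cX≋YZ))

splitting-scaleˡ : ∀ {X Y Y₁ Z p} → p ≢ 0ℤ → Y ≋ scale p Y₁ → ConstantSplitting X Y₁ Z → ConstantSplitting X Y Z
splitting-scaleˡ {p = p} p≢0 Y≋pY₁ (splitting u a b Y' Z' u± a≢0 b≢0 Y₁≋aY' Z≋bZ' X≋uY'Z') =
  splitting u (p · a) b Y' Z' u± (*-≢0 p a p≢0 a≢0) b≢0
    (≋-trans Y≋pY₁ (≋-trans (scale-cong Y₁≋aY') (scale-scale p a Y'))) Z≋bZ' X≋uY'Z'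

splitting-scaleʳ : ∀ {X Y Z Z₁ p} → p ≢ 0ℤ → Z ≋ scale p Z₁ → ConstantSplitting X Y Z₁ → ConstantSplitting X Y Z
splitting-scaleʳ {p = p} p≢0 Z≋pZ₁ (splitting u a b Y' Z' u± a≢0 b≢0 Y≋aY' Z₁≋bZ' X≋uY'Z') =
  splitting u a (p · b) Y' Z' u± a≢0 (*-≢0 p b p≢0 b≢0)
    Y≋aY' (≋-trans Z≋pZ₁ (≋-trans (scale-cong Z₁≋bZ') (scale-scale p b Z'))) X≋uY'Z'

-- Induction on ∣ c ∣: a prime factor p of c divides Y or Z by Gauss's lemma and is moved there.
constantSplitting′ : ∀ fuel c X Y Z → ℤ.∣ c ∣ ≤ fuel → c ≢ 0ℤ → scale c X ≋ Y *ₚ Z → ConstantSplitting X Y Z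
constantSplitting′ fuel c X Y Z ∣c∣≤fuel c≢0 cX≋YZ with ℤ.∣ c ∣ N.≤? 1
... | yes ∣c∣≤1 = splitting-Sign (∣i∣≤1⇒Sign c c≢0 ∣c∣≤1) cX≋YZ
constantSplitting′ zero c X Y Z ∣c∣≤0 c≢0 cX≋YZ | no ∣c∣≰1 = ⊥-elim (∣c∣≰1 (NP.≤-trans ∣c∣≤0 z≤n))
constantSplitting′ (suc fuel) c X Y Z ∣c∣≤1+fuel c≢0 cX≋YZ | no ∣c∣≰1 with primeDivisor ℤ.∣ c ∣ (NP.≰⇒> ∣c∣≰1)
... | p , p-prime , p∣c = splitOff (gauss p-prime Y Z p∣YZ)
  where
  p≢0 = prime⇒+p≢0 p-prime
  +p∣c : (+ p) DS.∣ c
  +p∣c = DS.∣ᵤ⇒∣ {+ p} {c} p∣c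
  c' = DS._∣_.quotient +p∣c
  c≡c'p : c ≡ c' · + p
  c≡c'p = DS._∣_.equality +p∣c
  c'≢0 : c' ≢ 0ℤ
  c'≢0 c'≡0 = c≢0 (trans c≡c'p (cong (_· + p) c'≡0))
  ∣c'∣<∣c∣ : ℤ.∣ c' ∣ < ℤ.∣ c ∣
  ∣c'∣<∣c∣ = subst (ℤ.∣ c' ∣ <_) (sym (trans (cong ℤ.∣_∣ c≡c'p) (ZP.abs-* c' (+ p))))
    (NP.m<m*n _ p {{N.>-nonZero (i≢0⇒∣i∣≥1 c' c'≢0)}} (prime⇒>1 p-prime))
  ∣c'∣≤fuel : ℤ.∣ c' ∣ ≤ fuel
  ∣c'∣≤fuel = NP.≤-pred (NP.≤-trans ∣c'∣<∣c∣ ∣c∣≤1+fuel)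
  pc'X≋YZ : scale (+ p) (scale c' X) ≋ Y *ₚ Z
  pc'X≋YZ = ≋-trans (scale-scale (+ p) c' X)
    (≋-trans (≋-reflexive (cong (λ u → scale u X) (trans (ZP.*-comm (+ p) c') (sym c≡c'p)))) cX≋YZ)
  p∣YZ : AllDivisible p (Y *ₚ Z)
  p∣YZ n = subst ((+ p) DS.∣_) (trans (sym (coeff-scale (+ p) (scale c' X) n)) (at pc'X≋YZ n))
    (DS.∣m⇒∣m*n (coeff (scale c' X) n) DS.∣-refl)
  splitOff : AllDivisible p Y ⊎ AllDivisible p Z → ConstantSplitting X Y Z
  splitOff (inj₁ p∣Y) with divideOut p Y p∣Y
  ... | Y₁ , Y≋pY₁ = splitting-scaleˡ p≢0 Y≋pY₁ (constantSplitting′ fuel c' X Y₁ Z ∣c'∣≤fuel c'≢0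
          (scale-cancel (+ p) p≢0 (≋-trans pc'X≋YZ (≋-trans (*ₚ-congʳ Z Y≋pY₁) (scale-*ₚˡ (+ p) Y₁ Z)))))
  splitOff (inj₂ p∣Z) with divideOut p Z p∣Z
  ... | Z₁ , Z≋pZ₁ = splitting-scaleʳ p≢0 Z≋pZ₁ (constantSplitting′ fuel c' X Y Z₁ ∣c'∣≤fuel c'≢0
          (scale-cancel (+ p) p≢0 (≋-trans pc'X≋YZ (≋-trans (*ₚ-congˡ Y Z≋pZ₁) (scale-*ₚʳ (+ p) Y Z₁)))))

constantSplitting : ∀ {c} X Y Z → c ≢ 0ℤ → scale c X ≋ Y *ₚ Z → ConstantSplitting X Y Z
constantSplitting {c} X Y Z = constantSplitting′ ℤ.∣ c ∣ c X Y Z NP.≤-refl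

-- Euclid's lemma for monic irreducible polynomials

record MonicIrreducible (F : Poly) (d : ℕ) : Set where
  constructor mk-irreducible
  field
    isMonic : MonicOfDegree F d
    1≤deg : 1 ≤ d
    factors : ∀ X Y → F ≋ X *ₚ Y → deg X ≡ 0 ⊎ deg Y ≡ 0
open MonicIrreducible public

Deg<⇒deg< : ∀ R d → NonZeroₚ R → Deg< R d → deg R < d
Deg<⇒deg< R d R≉0 R<d with deg R N.<? d
... | yes degR<d = degR<d
... | no degR≮d = ⊥-elim (lead≢0 R R≉0 (trans (sym (coeff-deg R)) (R<d (deg R) (NP.≮⇒≥ degR≮d))))

monic-associate : ∀ F d a F' → MonicOfDegree F d → F ≋ scale a F' → Sign a × F' ≋ scale a F
monic-associate F d a F' (mk-monic _ top) F≋aF' =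
  a± , ≋-sym (≋-trans (scale-cong F≋aF') (scale-Sign-involutive a± F'))
  where
  a± : Sign a
  a± = i*j≡1⇒Sign a (coeff F' d) (trans (sym (coeff-scale a F' d)) (trans (sym (at F≋aF' d)) top))

∣scale⇒∣ : ∀ F d → MonicOfDegree F d → ∀ c C W → c ≢ 0ℤ → scale c C ≋ F *ₚ W → F ∣ C
∣scale⇒∣ F d mF c C W c≢0 cC≋FW with constantSplitting C F W c≢0 cC≋FW
... | splitting u a _ F' W' _ _ _ F≋aF' _ C≋uF'W' with monic-associate F d a F' mF F≋aF'
...   | _ , F'≋aF = scale (u · a) W' , (begin
  C                           ≈⟨ C≋uF'W' ⟩
  scale u (F' *ₚ W')          ≈⟨ scale-cong (*ₚ-congʳ W' F'≋aF) ⟩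
  scale u (scale a F *ₚ W')   ≈⟨ scale-cong (scale-*ₚˡ a F W') ⟩
  scale u (scale a (F *ₚ W')) ≈⟨ scale-scale u a (F *ₚ W') ⟩
  scale (u · a) (F *ₚ W')     ≈⟨ scale-*ₚʳ (u · a) F W' ⟨
  F *ₚ scale (u · a) W'       ∎)
  where open ≋-Reasoning

scaled-factorisation : ∀ {F d c} R Q → MonicIrreducible F d → c ≢ 0ℤ → scale c F ≋ R *ₚ Q → NonZeroₚ R →
  deg R ≡ 0 ⊎ deg R ≡ d
scaled-factorisation {F} {d} R Q irrF c≢0 cF≋RQ R≉0 with constantSplitting F R Q c≢0 cF≋RQ
... | splitting u a _ R' Q' u± a≢0 _ R≋aR' _ F≋uR'Q' =
  Sum.map (trans degR≡deg-uR') degR≡d (factors irrF (scale u R') Q' F≋uR'·Q')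
  where
  F≋uR'·Q' : F ≋ scale u R' *ₚ Q'
  F≋uR'·Q' = ≋-trans F≋uR'Q' (≋-sym (scale-*ₚˡ u R' Q'))
  R'≉0 : NonZeroₚ R'
  R'≉0 R'≋0 = R≉0 (≋-trans R≋aR' (scale-cong R'≋0))
  uR'≉0 : NonZeroₚ (scale u R')
  uR'≉0 uR'≋0 = R'≉0 (≋-trans (≋-sym (scale-Sign-involutive u± R')) (scale-cong uR'≋0))
  Q'≉0 : NonZeroₚ Q'
  Q'≉0 Q'≋0 = MonicOfDegree⇒NonZeroₚ F d (isMonic irrF)
    (≋-trans F≋uR'Q' (scale-cong (≋-trans (*ₚ-congˡ R' Q'≋0) (*ₚ-zeroʳ R'))))
  degR≡deg-uR' : deg R ≡ deg (scale u R')
  degR≡deg-uR' = trans (deg-cong R≋aR') (trans (deg-scale a R' a≢0 R'≉0) (sym (deg-scale u R' (Sign⇒≢0 u u±) R'≉0)))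
  degR≡d : deg Q' ≡ 0 → deg R ≡ d
  degR≡d degQ'≡0 = begin
    deg R                        ≡⟨ degR≡deg-uR' ⟩
    deg (scale u R')             ≡⟨ NP.+-identityʳ _ ⟨
    deg (scale u R') +ℕ 0        ≡⟨ cong (deg (scale u R') +ℕ_) degQ'≡0 ⟨
    deg (scale u R') +ℕ deg Q'   ≡⟨ deg-*ₚ (scale u R') Q' uR'≉0 Q'≉0 ⟨
    deg (scale u R' *ₚ Q')       ≡⟨ deg-cong F≋uR'·Q' ⟨
    deg F                        ≡⟨ MonicOfDegree⇒deg F d (isMonic irrF) ⟩
    d                            ∎
    where open ≡-Reasoning

∣-*ₚ-comm : ∀ F X Y Z → F ∣ (X *ₚ Y) → F ∣ (X *ₚ Z) *ₚ Y
∣-*ₚ-comm F X Y Z (W , XY≋FW) = Z *ₚ W , (begin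
  (X *ₚ Z) *ₚ Y    ≈⟨ *ₚ-assoc X Z Y ⟩
  X *ₚ (Z *ₚ Y)    ≈⟨ *ₚ-congˡ X (*ₚ-comm Z Y) ⟩
  X *ₚ (Y *ₚ Z)    ≈⟨ *ₚ-assoc X Y Z ⟨
  (X *ₚ Y) *ₚ Z    ≈⟨ *ₚ-congʳ Z XY≋FW ⟩
  (F *ₚ W) *ₚ Z    ≈⟨ *ₚ-assoc F W Z ⟩
  F *ₚ (W *ₚ Z)    ≈⟨ *ₚ-congˡ F (*ₚ-comm W Z) ⟩
  F *ₚ (Z *ₚ W)    ∎)
  where open ≋-Reasoning

remainder-∣ : ∀ F X P R C → X ≋ P +ₚ R → F ∣ X *ₚ C → F ∣ P *ₚ C → F ∣ R *ₚ C
remainder-∣ F X P R C X≋P+R (V , XC≋FV) (W , PC≋FW) = V -ₚ W , (begin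
  R *ₚ C              ≈⟨ *ₚ-congʳ C (≋+ₚ⇒≋-ₚ P R X≋P+R) ⟩
  (X -ₚ P) *ₚ C       ≈⟨ *ₚ-distribʳ--ₚ X P C ⟩
  X *ₚ C -ₚ P *ₚ C    ≈⟨ -ₚ-cong XC≋FV PC≋FW ⟩
  F *ₚ V -ₚ F *ₚ W    ≈⟨ *ₚ-distribˡ--ₚ F V W ⟨
  F *ₚ (V -ₚ W)       ∎)
  where open ≋-Reasoning

-- Induction on deg R: pseudo-divide F by R and pass to the remainder.
euclid-lowDegree : ∀ F d → MonicIrreducible F d → ∀ fuel R C → NonZeroₚ R → deg R < fuel → deg R < d →
  F ∣ R *ₚ C → F ∣ C
euclid-lowDegree F d irrF zero R C _ () _ _
euclid-lowDegree F d irrF (suc fuel) R C R≉0 degR<1+fuel degR<d (W , RC≋FW) with deg R N.≟ 0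
... | yes degR≡0 = ∣scale⇒∣ F d (isMonic irrF) (coeff R 0) C W R₀≢0
  (≋-trans (≋-sym ([c]-*ₚ (coeff R 0) C)) (≋-trans (*ₚ-congʳ C (≋-sym (deg≡0⇒constant R degR≡0))) RC≋FW))
  where
  R₀≢0 : coeff R 0 ≢ 0ℤ
  R₀≢0 R₀≡0 = lead≢0 R R≉0 (trans (sym (coeff-deg R)) (trans (cong (coeff R) degR≡0) R₀≡0))
... | no degR≢0 with pseudoDivide R (deg R) (Deg≤-deg R) (suc (deg F)) F (Deg≤-deg F)
...   | N , Q , R' , cᴺF≋RQ+R' , R'<degR = reduce (≋[]? R')
  where
  c = coeff R (deg R)
  cᴺ≢0 : c ^ N ≢ 0ℤ
  cᴺ≢0 cᴺ≡0 = lead≢0 R R≉0 (trans (sym (coeff-deg R)) (ZP.i^n≡0⇒i≡0 c N cᴺ≡0))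
  F∣R'C : F ∣ R' *ₚ C
  F∣R'C = remainder-∣ F (scale (c ^ N) F) (R *ₚ Q) R' C cᴺF≋RQ+R'
    (scale (c ^ N) C , ≋-trans (scale-*ₚˡ (c ^ N) F C) (≋-sym (scale-*ₚʳ (c ^ N) F C)))
    (∣-*ₚ-comm F R C Q (W , RC≋FW))
  reduce : Dec (R' ≋ []) → F ∣ C
  reduce (no R'≉0) = euclid-lowDegree F d irrF fuel R' C R'≉0
    (NP.<-≤-trans degR'<degR (NP.≤-pred degR<1+fuel)) (NP.<-trans degR'<degR degR<d) F∣R'C
    where
    degR'<degR : deg R' < deg R
    degR'<degR = Deg<⇒deg< R' (deg R) R'≉0 R'<degR
  reduce (yes R'≋0) = ⊥-elim (Sum.[ degR≢0 , (λ degR≡d → NP.<-irrefl degR≡d degR<d) ]′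
    (scaled-factorisation R Q irrF cᴺ≢0 (≋-trans cᴺF≋RQ+R' (≋-trans (+ₚ-cong ≋-refl R'≋0) (+ₚ-identityʳ _))) R≉0))

euclidsLemmaₚ : ∀ F d → MonicIrreducible F d → ∀ B C → F ∣ B *ₚ C → F ∣ B ⊎ F ∣ C
euclidsLemmaₚ F d irrF B C F∣BC with divideByMonic F d (isMonic irrF) B
... | Q , R , B≋FQ+R , R<d with ≋[]? R
...   | yes R≋0 = inj₁ (Q , ≋-trans B≋FQ+R (≋-trans (+ₚ-cong ≋-refl R≋0) (+ₚ-identityʳ _)))
...   | no R≉0 = inj₂ (euclid-lowDegree F d irrF (suc (deg R)) R C R≉0 NP.≤-refl (Deg<⇒deg< R d R≉0 R<d)
          (remainder-∣ F B (F *ₚ Q) R C B≋FQ+R F∣BC (Q *ₚ C , *ₚ-assoc F Q C)))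

linear : ℤ → Poly
linear x = (- x) ∷ 1ℤ ∷ []

linear-monic : ∀ x → MonicOfDegree (linear x) 1
linear-monic x = mk-monic (λ { (suc (suc k)) _ → refl ; (suc zero) (s≤s ()) ; zero () }) refl

eval-linear : ∀ x y → eval y (linear x) ≡ y - x
eval-linear = simplify
  where
  simplify : ∀ x y → - x + y · (1ℤ + y · 0ℤ) ≡ y - x
  simplify = solve-∀

divideByLinear : ∀ x g → Σ Poly λ g₁ → g ≋ (eval x g ∷ []) +ₚ linear x *ₚ g₁
divideByLinear x g with divideByMonic (linear x) 1 (linear-monic x) g
... | Q , R , g≋LQ+R , R≤0 = Q , ≋-trans g≋LQ+R (≋-trans (+ₚ-comm (linear x *ₚ Q) R) (+ₚ-cong R≋[g[x]] ≋-refl))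
  where
  R≋[R₀] : R ≋ coeff R 0 ∷ []
  R≋[R₀] = Deg≤0⇒constant R R≤0
  R≋[g[x]] : R ≋ eval x g ∷ []
  R≋[g[x]] = ≋-trans R≋[R₀] (∷-cong (sym (begin
    eval x g                           ≡⟨ eval-cong x g≋LQ+R ⟩
    eval x (linear x *ₚ Q +ₚ R)         ≡⟨ eval-+ₚ x (linear x *ₚ Q) R ⟩
    eval x (linear x *ₚ Q) + eval x R   ≡⟨ cong₂ _+_ L[x]Q[x]≡0 (eval-cong x R≋[R₀]) ⟩
    0ℤ + (coeff R 0 + x · 0ℤ)          ≡⟨ ZP.+-identityˡ _ ⟩
    coeff R 0 + x · 0ℤ                 ≡⟨ cong (λ z → coeff R 0 + z) (ZP.*-zeroʳ x) ⟩
    coeff R 0 + 0ℤ                     ≡⟨ ZP.+-identityʳ (coeff R 0) ⟩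
    coeff R 0                          ∎)) ≋-refl)
    where
    open ≡-Reasoning
    L[x]Q[x]≡0 : eval x (linear x *ₚ Q) ≡ 0ℤ
    L[x]Q[x]≡0 = trans (eval-*ₚ x (linear x) Q)
      (trans (cong (_· eval x Q) (trans (eval-linear x x) (ZP.+-inverseʳ x))) (ZP.*-zeroˡ (eval x Q)))

factorTheorem : ∀ x X → eval x X ≡ 0ℤ → linear x ∣ X
factorTheorem x X X[x]≡0 with divideByLinear x X
... | X₁ , X≋[X[x]]+LX₁ = X₁ , ≋-trans X≋[X[x]]+LX₁ (mk≋ λ n →
  trans (coeff-+ₚ (eval x X ∷ []) (linear x *ₚ X₁) n) (trans (cong (_+ coeff (linear x *ₚ X₁) n) (coeff-[0] n)) (ZP.+-identityˡ _)))
  where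
  coeff-[0] : ∀ n → coeff (eval x X ∷ []) n ≡ 0ℤ
  coeff-[0] zero = X[x]≡0
  coeff-[0] (suc n) = refl

-- Kronecker's method

-- Newton interpolation at k, k+1, …, k+m: g = g(k) + (T - k) g₁, where g₁(k+t) = (g(k+t) - g(k)) / t.
divideDifferences : ℕ → ℤ → List ℤ → Maybe (List ℤ)
divideDifferences i v₀ [] = just []
divideDifferences i v₀ (v ∷ vs) with (+ i) DS.∣? (v - v₀)
... | yes i∣v-v₀ = divideDifferences (suc i) v₀ vs >>= λ ws → just (DS._∣_.quotient i∣v-v₀ ∷ ws)
... | no _ = nothing

interpolate : ℕ → ℕ → List ℤ → Maybe Poly
interpolate k zero [] = nothing
interpolate k zero (v₀ ∷ vs) = just (v₀ ∷ [])
interpolate k (suc m) [] = nothing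
interpolate k (suc m) (v₀ ∷ vs) =
  divideDifferences 1 v₀ vs >>= λ ws → interpolate (suc k) m ws >>= λ g₁ → just ((v₀ ∷ []) +ₚ linear (+ k) *ₚ g₁)

samples : ℕ → ℕ → Poly → List ℤ
samples j zero g = eval (+ j) g ∷ []
samples j (suc m) g = eval (+ j) g ∷ samples (suc j) m g

divideDifferences-samples : ∀ k g g₁ v₀ → (∀ t → eval (+ (k +ℕ t)) g ≡ + t · eval (+ (k +ℕ t)) g₁ + v₀) →
  ∀ m i → 1 ≤ i → divideDifferences i v₀ (samples (k +ℕ i) m g) ≡ just (samples (k +ℕ i) m g₁)
divideDifferences-samples k g g₁ v₀ values = go
  where
  cancel : ∀ a b → a + b - b ≡ a
  cancel = solve-∀
  difference : ∀ i → eval (+ (k +ℕ i)) g - v₀ ≡ + i · eval (+ (k +ℕ i)) g₁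
  difference i = trans (cong (_- v₀) (values i)) (cancel _ v₀)
  divisible : ∀ i → (+ i) DS.∣ (eval (+ (k +ℕ i)) g - v₀)
  divisible i = DS.divides (eval (+ (k +ℕ i)) g₁) (trans (difference i) (ZP.*-comm (+ i) _))
  quotient≡ : ∀ i → 1 ≤ i → (i∣ : (+ i) DS.∣ (eval (+ (k +ℕ i)) g - v₀)) → DS._∣_.quotient i∣ ≡ eval (+ (k +ℕ i)) g₁
  quotient≡ i@(suc _) _ i∣ =
    ZP.*-cancelʳ-≡ _ _ (+ i) (trans (sym (DS._∣_.equality i∣)) (trans (difference i) (ZP.*-comm (+ i) _)))
  go : ∀ m i → 1 ≤ i → divideDifferences i v₀ (samples (k +ℕ i) m g) ≡ just (samples (k +ℕ i) m g₁)
  go zero i 1≤i with (+ i) DS.∣? (eval (+ (k +ℕ i)) g - v₀)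
  ... | yes i∣ = cong (λ z → just (z ∷ [])) (quotient≡ i 1≤i i∣)
  ... | no i∤ = ⊥-elim (i∤ (divisible i))
  go (suc m) i 1≤i with (+ i) DS.∣? (eval (+ (k +ℕ i)) g - v₀)
  ... | yes i∣ rewrite sym (NP.+-suc k i) | go m (suc i) (s≤s z≤n) =
    cong (λ z → just (z ∷ samples (k +ℕ suc i) m g₁)) (quotient≡ i 1≤i i∣)
  ... | no i∤ = ⊥-elim (i∤ (divisible i))

quotientByLinear-Deg≤ : ∀ x g g₁ m → Deg≤ g (suc m) → g ≋ (eval x g ∷ []) +ₚ linear x *ₚ g₁ → Deg≤ g₁ m
quotientByLinear-Deg≤ x g g₁ m g≤1+m g≋[g[x]]+Lg₁ with g₁ ≋? []
... | yes g₁≋0 = λ k _ → at g₁≋0 k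
... | no g₁≉0 = deg≤⇒Deg≤ g₁ m (NP.≤-pred (subst (_≤ suc m) degLg₁ (Deg≤⇒deg≤ (L *ₚ g₁) (suc m) Lg₁≤1+m)))
  where
  L = linear x
  Lg₁≤1+m : Deg≤ (L *ₚ g₁) (suc m)
  Lg₁≤1+m (suc j) 1+m<1+j = trans (sym (trans (at g≋[g[x]]+Lg₁ (suc j))
    (trans (coeff-+ₚ (eval x g ∷ []) (L *ₚ g₁) (suc j)) (ZP.+-identityˡ _)))) (g≤1+m (suc j) 1+m<1+j)
  degLg₁ : deg (L *ₚ g₁) ≡ suc (deg g₁)
  degLg₁ = trans (deg-*ₚ L g₁ (MonicOfDegree⇒NonZeroₚ L 1 (linear-monic x)) g₁≉0)
    (cong (_+ℕ deg g₁) (MonicOfDegree⇒deg L 1 (linear-monic x)))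

eval-divideByLinear : ∀ k g g₁ → g ≋ (eval (+ k) g ∷ []) +ₚ linear (+ k) *ₚ g₁ →
  ∀ t → eval (+ (k +ℕ t)) g ≡ + t · eval (+ (k +ℕ t)) g₁ + eval (+ k) g
eval-divideByLinear k g g₁ g≋[g[k]]+Lg₁ t = begin
  eval x g                                   ≡⟨ eval-cong x g≋[g[k]]+Lg₁ ⟩
  eval x ((v₀ ∷ []) +ₚ L *ₚ g₁)              ≡⟨ eval-+ₚ x (v₀ ∷ []) (L *ₚ g₁) ⟩
  (v₀ + x · 0ℤ) + eval x (L *ₚ g₁)           ≡⟨ swap v₀ (eval x (L *ₚ g₁)) x ⟩
  eval x (L *ₚ g₁) + v₀                      ≡⟨ cong (_+ v₀) (eval-*ₚ x L g₁) ⟩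
  eval x L · eval x g₁ + v₀                  ≡⟨ cong (λ l → l · eval x g₁ + v₀) (trans (eval-linear (+ k) x) x-k≡t) ⟩
  + t · eval x g₁ + v₀                       ∎
  where
  open ≡-Reasoning
  x = + (k +ℕ t)
  v₀ = eval (+ k) g
  L = linear (+ k)
  swap : ∀ a b c → (a + c · 0ℤ) + b ≡ b + a
  swap = solve-∀
  x-k≡t : x - + k ≡ + t
  x-k≡t = trans (cong (_- + k) (ZP.pos-+ k t)) (i+j-i≡j (+ k) (+ t))

interpolate-samples : ∀ m k g → Deg≤ g m → Σ Poly λ g' → (interpolate k m (samples k m g) ≡ just g') × g' ≋ g
interpolate-samples zero k g g≤0 = (eval (+ k) g ∷ []) , refl , ≋-trans (∷-cong g[k]≡g₀ ≋-refl) (≋-sym (Deg≤0⇒constant g g≤0))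
  where
  g[k]≡g₀ : eval (+ k) g ≡ coeff g 0
  g[k]≡g₀ = trans (eval-cong (+ k) (Deg≤0⇒constant g g≤0))
    (trans (cong (λ z → coeff g 0 + z) (ZP.*-zeroʳ (+ k))) (ZP.+-identityʳ (coeff g 0)))
interpolate-samples (suc m) k g g≤1+m with divideByLinear (+ k) g
... | g₁ , g≋[g[k]]+Lg₁ with interpolate-samples m (suc k) g₁ (quotientByLinear-Deg≤ (+ k) g g₁ m g≤1+m g≋[g[k]]+Lg₁)
...   | g₁' , interpolate≡g₁' , g₁'≋g₁ = (eval (+ k) g ∷ []) +ₚ linear (+ k) *ₚ g₁' , interpolation , reconstruction
  where
  differences : divideDifferences 1 (eval (+ k) g) (samples (suc k) m g) ≡ just (samples (suc k) m g₁)
  differences = subst (λ j → divideDifferences 1 (eval (+ k) g) (samples j m g) ≡ just (samples j m g₁)) (NP.+-comm k 1)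
    (divideDifferences-samples k g g₁ (eval (+ k) g) (eval-divideByLinear k g g₁ g≋[g[k]]+Lg₁) m 1 (s≤s z≤n))
  interpolation : interpolate k (suc m) (samples k (suc m) g) ≡ just ((eval (+ k) g ∷ []) +ₚ linear (+ k) *ₚ g₁')
  interpolation rewrite differences | interpolate≡g₁' = refl
  reconstruction : (eval (+ k) g ∷ []) +ₚ linear (+ k) *ₚ g₁' ≋ g
  reconstruction = ≋-trans (+ₚ-cong (≋-refl {eval (+ k) g ∷ []}) (*ₚ-congˡ (linear (+ k)) g₁'≋g₁)) (≋-sym g≋[g[k]]+Lg₁)

searchℤ : ∀ (P N : ℤ → Set) → (∀ a → P a ⊎ N a) → ∀ B → Σ ℤ P ⊎ (∀ a → ℤ.∣ a ∣ ≤ B → N a)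
searchℤ P N decide zero with decide 0ℤ
... | inj₁ P0 = inj₁ (_ , P0)
... | inj₂ N0 = inj₂ λ { (+ zero) _ → N0 ; (+ suc k) () ; -[1+ k ] () }
searchℤ P N decide (suc B) with decide (+ suc B) | decide -[1+ B ] | searchℤ P N decide B
... | inj₁ P+ | _ | _ = inj₁ (_ , P+)
... | inj₂ _ | inj₁ P- | _ = inj₁ (_ , P-)
... | inj₂ _ | inj₂ _ | inj₁ found = inj₁ found
... | inj₂ N+ | inj₂ N- | inj₂ below = inj₂ none
  where
  none : ∀ a → ℤ.∣ a ∣ ≤ suc B → N a
  none a ∣a∣≤1+B with NP.m≤n⇒m<n∨m≡n ∣a∣≤1+B
  ... | inj₁ ∣a∣<1+B = below a (NP.≤-pred ∣a∣<1+B)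
  none (+ .(suc B)) _ | inj₂ refl = N+
  none -[1+ .B ] _ | inj₂ refl = N-

Fits : List ℤ → List ℕ → Set
Fits [] [] = ⊤
Fits [] (_ ∷ _) = ⊥
Fits (_ ∷ _) [] = ⊥
Fits (a ∷ v) (B ∷ Bs) = ℤ.∣ a ∣ ≤ B × Fits v Bs

searchBox : ∀ (P : List ℤ → Set) → (∀ v → Dec (P v)) → ∀ Bs → Σ (List ℤ) P ⊎ (∀ v → Fits v Bs → ¬ P v)
searchBox P P? [] with P? []
... | yes P[] = inj₁ (_ , P[])
... | no ¬P[] = inj₂ λ { [] _ → ¬P[] ; (_ ∷ _) () }
searchBox P P? (B ∷ Bs) with searchℤ (λ a → Σ (List ℤ) λ v → P (a ∷ v)) (λ a → ∀ v → Fits v Bs → ¬ P (a ∷ v))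
                               (λ a → searchBox (λ v → P (a ∷ v)) (λ v → P? (a ∷ v)) Bs) B
... | inj₁ (a , v , Pa∷v) = inj₁ (a ∷ v , Pa∷v)
... | inj₂ none = inj₂ λ { [] () ; (a ∷ v) (∣a∣≤B , v-fits) → none a ∣a∣≤B v v-fits }

searchℕ : ∀ (P N : ℕ → Set) → (∀ i → P i ⊎ N i) → ∀ n → (Σ ℕ λ i → i < n × P i) ⊎ (∀ i → i < n → N i)
searchℕ P N decide zero = inj₂ λ i ()
searchℕ P N decide (suc n) with decide n | searchℕ P N decide n
... | inj₁ Pn | _ = inj₁ (n , NP.≤-refl , Pn)
... | inj₂ _ | inj₁ (i , i<n , Pi) = inj₁ (i , NP.≤-trans i<n (NP.n≤1+n n) , Pi)
... | inj₂ Nn | inj₂ below = inj₂ none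
  where
  none : ∀ i → i < suc n → N i
  none i i<1+n with NP.m≤n⇒m<n∨m≡n i<1+n
  ... | inj₁ i+1<1+n = below i (NP.≤-pred i+1<1+n)
  none .n _ | inj₂ refl = Nn

KroneckerCandidate : Poly → ℕ → List ℤ → Set
KroneckerCandidate X e v = Σ Poly λ g → (interpolate 0 e v ≡ just g) × deg g ≡ e × lead g ≡ 1ℤ × g ∣ X

kroneckerCandidate? : ∀ X e v → Dec (KroneckerCandidate X e v)
kroneckerCandidate? X e v with interpolate 0 e v
... | nothing = no λ { (_ , () , _) }
... | just g with deg g N.≟ e | lead g ZP.≟ 1ℤ
...   | no deg≢e | _ = no λ { (_ , refl , deg≡e , _) → deg≢e deg≡e }
...   | yes _ | no lead≢1 = no λ { (_ , refl , _ , lead≡1 , _) → lead≢1 lead≡1 }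
...   | yes deg≡e | yes lead≡1 with monic-∣? g e (monicOfDegree g e deg≡e lead≡1) X
...     | yes g∣X = yes (g , refl , deg≡e , lead≡1 , g∣X)
...     | no g∤X = no λ { (_ , refl , _ , _ , g∣X) → g∤X g∣X }

∣i∣≤∣i*j∣ : ∀ a b → a · b ≢ 0ℤ → ℤ.∣ a ∣ ≤ ℤ.∣ a · b ∣
∣i∣≤∣i*j∣ a b ab≢0 = subst (ℤ.∣ a ∣ ≤_) (sym (ZP.abs-* a b)) (NP.m≤m*n _ _ {{N.>-nonZero (i≢0⇒∣i∣≥1 b b≢0)}})
  where
  b≢0 : b ≢ 0ℤ
  b≢0 b≡0 = ab≢0 (trans (cong (a ·_) b≡0) (ZP.*-zeroʳ a))

samples-fit : ∀ g X m j → (∀ i → i ≤ j +ℕ m → ℤ.∣ eval (+ i) g ∣ ≤ ℤ.∣ eval (+ i) X ∣) →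
  Fits (samples j m g) (map ℤ.∣_∣ (samples j m X))
samples-fit g X zero j bound = bound j (NP.≤-reflexive (sym (NP.+-identityʳ j))) , tt
samples-fit g X (suc m) j bound =
  bound j (NP.m≤m+n j _) , samples-fit g X m (suc j) (λ i i≤ → bound i (subst (i ≤_) (sym (NP.+-suc j m)) i≤))

-- A monic factor g of degree e has g(i) ∣ X(i) ≠ 0, hence ∣ g(i) ∣ ≤ ∣ X(i) ∣ for i ≤ e, and g is recovered
-- from these values by interpolation: it suffices to search a finite box of value vectors.
kronecker : ∀ X e → (∀ i → i ≤ e → eval (+ i) X ≢ 0ℤ) →
  (Σ Poly λ g → MonicOfDegree g e × g ∣ X) ⊎ (∀ g → MonicOfDegree g e → ¬ g ∣ X)
kronecker X e X≢0 with searchBox (KroneckerCandidate X e) (kroneckerCandidate? X e) (map ℤ.∣_∣ (samples 0 e X))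
... | inj₁ (_ , g , _ , deg≡e , lead≡1 , g∣X) = inj₁ (g , monicOfDegree g e deg≡e lead≡1 , g∣X)
... | inj₂ none = inj₂ λ g mg g∣X → none (samples 0 e g) (samples-fit g X e 0 (bound g g∣X)) (candidate g mg g∣X)
  where
  bound : ∀ g → g ∣ X → ∀ i → i ≤ e → ℤ.∣ eval (+ i) g ∣ ≤ ℤ.∣ eval (+ i) X ∣
  bound g (h , X≋gh) i i≤e = subst (λ z → ℤ.∣ eval (+ i) g ∣ ≤ ℤ.∣ z ∣) (sym X[i]≡g[i]h[i])
    (∣i∣≤∣i*j∣ (eval (+ i) g) (eval (+ i) h) (λ gh≡0 → X≢0 i i≤e (trans X[i]≡g[i]h[i] gh≡0)))
    where
    X[i]≡g[i]h[i] : eval (+ i) X ≡ eval (+ i) g · eval (+ i) h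
    X[i]≡g[i]h[i] = trans (eval-cong (+ i) X≋gh) (eval-*ₚ (+ i) g h)
  candidate : ∀ g → MonicOfDegree g e → g ∣ X → KroneckerCandidate X e (samples 0 e g)
  candidate g mg (h , X≋gh) with interpolate-samples e 0 g (bounded mg)
  ... | g' , interpolate≡g' , g'≋g = g' , interpolate≡g' , trans (deg-cong g'≋g) (MonicOfDegree⇒deg g e mg) ,
          trans (lead-cong g'≋g) (MonicOfDegree⇒lead g e mg) , h , ≋-trans X≋gh (*ₚ-congʳ h (≋-sym g'≋g))

ProperMonicFactor : Poly → ℕ → Set
ProperMonicFactor X n = Σ Poly λ g → Σ ℕ λ e → MonicOfDegree g e × 1 ≤ e × e < n × g ∣ X

NoProperMonicFactor : Poly → ℕ → Set
NoProperMonicFactor X n = ∀ g e → MonicOfDegree g e → 1 ≤ e → e < n → ¬ g ∣ X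

monicFactorOfDegree? : ∀ X n → (∀ i → i < n → eval (+ i) X ≢ 0ℤ) → ∀ e →
  (1 ≤ e × Σ Poly λ g → MonicOfDegree g e × g ∣ X) ⊎ (1 ≤ e → e < n → ∀ g → MonicOfDegree g e → ¬ g ∣ X)
monicFactorOfDegree? X n X≢0 zero = inj₂ λ ()
monicFactorOfDegree? X n X≢0 (suc e) with suc e N.<? n
... | no 1+e≮n = inj₂ λ _ 1+e<n → ⊥-elim (1+e≮n 1+e<n)
... | yes 1+e<n = Sum.map (s≤s z≤n ,_) (λ none _ _ → none) (kronecker X (suc e) (λ i i≤1+e → X≢0 i (NP.≤-<-trans i≤1+e 1+e<n)))

-- A root i < n gives the factor T - i; without such roots Kronecker's method applies in each degree.
properMonicFactor? : ∀ X n → ProperMonicFactor X n ⊎ NoProperMonicFactor X n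
properMonicFactor? X n with n N.≤? 1
... | yes n≤1 = inj₂ λ g e _ 1≤e e<n _ → NP.<-irrefl refl (NP.≤-trans (NP.≤-trans (s≤s 1≤e) e<n) n≤1)
... | no n≰1 with searchℕ (λ i → eval (+ i) X ≡ 0ℤ) (λ i → eval (+ i) X ≢ 0ℤ) (λ i → toSum (eval (+ i) X ZP.≟ 0ℤ)) n
...   | inj₁ (i , _ , X[i]≡0) =
  inj₁ (linear (+ i) , 1 , linear-monic (+ i) , NP.≤-refl , NP.≰⇒> n≰1 , factorTheorem (+ i) X X[i]≡0)
...   | inj₂ X≢0 = Sum.map (λ (e , e<n , 1≤e , g , mg , g∣X) → g , e , mg , 1≤e , e<n , g∣X)
                           (λ none g e mg 1≤e e<n → none e e<n 1≤e e<n g mg)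
                           (searchℕ _ _ (monicFactorOfDegree? X n X≢0) n)

IsUnit-cong : ∀ {f g} → f ≋ g → IsUnit g → IsUnit f
IsUnit-cong {f} {g} f≋g (q , gq≈1) = q , ≋⇒≈ (f *ₚ q) 1ₚ (≋-trans (*ₚ-congʳ q f≋g) (≈⇒≋ {g *ₚ q} {1ₚ} gq≈1))

coeff0-*ₚ : ∀ p q → coeff (p *ₚ q) 0 ≡ coeff p 0 · coeff q 0
coeff0-*ₚ [] q = refl
coeff0-*ₚ (a ∷ p) q = trans (coeff-∷-*ₚ a p q 0) (ZP.+-identityʳ _)

monicFactors : ∀ P d f g → MonicOfDegree P d → P ≋ f *ₚ g → NonZeroₚ f × NonZeroₚ g × lead f · lead g ≡ 1ℤ
monicFactors P d f g mP P≋fg = f≉0 , g≉0 , trans (sym (lead-*ₚ f g f≉0 g≉0)) (trans (sym (lead-cong P≋fg)) (MonicOfDegree⇒lead P d mP))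
  where
  f≉0 : NonZeroₚ f
  f≉0 f≋0 = MonicOfDegree⇒NonZeroₚ P d mP (≋-trans P≋fg (*ₚ-congʳ g f≋0))
  g≉0 : NonZeroₚ g
  g≉0 g≋0 = MonicOfDegree⇒NonZeroₚ P d mP (≋-trans P≋fg (≋-trans (*ₚ-congˡ f g≋0) (*ₚ-zeroʳ f)))

deg≡0⇒IsUnit : ∀ P d f g → MonicOfDegree P d → P ≋ f *ₚ g → deg f ≡ 0 → IsUnit f
deg≡0⇒IsUnit P d f g mP P≋fg degf≡0 with monicFactors P d f g mP P≋fg
... | _ , _ , leads = IsUnit-cong (≋-trans (deg≡0⇒constant f degf≡0) (∷-cong f₀≡lead ≋-refl))
                        (Sign⇒IsUnit (lead f) (i*j≡1⇒Sign (lead f) (lead g) leads))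
  where
  f₀≡lead : coeff f 0 ≡ lead f
  f₀≡lead = trans (cong (coeff f) (sym degf≡0)) (coeff-deg f)

MonicIrreducible⇒Irreducible : ∀ F d → MonicIrreducible F d → Irreducible F
MonicIrreducible⇒Irreducible F d (mk-irreducible mF 1≤d factors) =
  (λ F≈0 → MonicOfDegree⇒NonZeroₚ F d mF (≈⇒≋ {F} {[]} F≈0)) ,
  (λ F-unit → NP.<-irrefl (sym (trans (sym (MonicOfDegree⇒deg F d mF)) (IsUnit⇒deg≡0 F F-unit))) 1≤d) ,
  λ f g F≈fg → unitFactor f g (≈⇒≋ {F} {f *ₚ g} F≈fg)
  where
  unitFactor : ∀ f g → F ≋ f *ₚ g → IsUnit f ⊎ IsUnit g
  unitFactor f g F≋fg with factors f g F≋fg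
  ... | inj₁ degf≡0 = inj₁ (deg≡0⇒IsUnit F d f g mF F≋fg degf≡0)
  ... | inj₂ degg≡0 = inj₂ (deg≡0⇒IsUnit F d g f mF (≋-trans F≋fg (*ₚ-comm f g)) degg≡0)

Irreducible-cong : ∀ {A F} → A ≋ F → Irreducible F → Irreducible A
Irreducible-cong {A} {F} A≋F (F≉0 , F-nonunit , F-factors) =
  (λ A≈0 → F≉0 (≋⇒≈ F [] (≋-trans (≋-sym A≋F) (≈⇒≋ A≈0)))) ,
  (λ A-unit → F-nonunit (IsUnit-cong (≋-sym A≋F) A-unit)) ,
  λ f g A≈fg → F-factors f g (≋⇒≈ F (f *ₚ g) (≋-trans (≋-sym A≋F) (≈⇒≋ A≈fg)))

Irreducible⇒¬Reducible : ∀ A → Irreducible A → ¬ Reducible A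
Irreducible⇒¬Reducible A (_ , _ , factors) (_ , _ , f , g , f-nonunit , g-nonunit , A≈fg) with factors f g A≈fg
... | inj₁ f-unit = f-nonunit f-unit
... | inj₂ g-unit = g-nonunit g-unit

-- A nonconstant factor A, multiplied by the sign lead A, is a proper monic factor.
noProperFactor⇒MonicIrreducible : ∀ X n → MonicOfDegree X n → 1 ≤ n → NoProperMonicFactor X n → MonicIrreducible X n
noProperFactor⇒MonicIrreducible X n mX 1≤n noProper = mk-irreducible mX 1≤n constantFactor
  where
  constantFactor : ∀ A B → X ≋ A *ₚ B → deg A ≡ 0 ⊎ deg B ≡ 0
  constantFactor A B X≋AB with deg A N.≟ 0 | deg B N.≟ 0
  ... | yes degA≡0 | _ = inj₁ degA≡0
  ... | no _ | yes degB≡0 = inj₂ degB≡0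
  ... | no degA≢0 | no degB≢0 with monicFactors X n A B mX X≋AB
  ...   | A≉0 , B≉0 , leads = ⊥-elim (noProper (scale a A) (deg A) mA' (NP.n≢0⇒n>0 degA≢0) degA<n (scale a B , X≋A'B'))
    where
    a = lead A
    a± = i*j≡1⇒Sign a (lead B) leads
    mA' : MonicOfDegree (scale a A) (deg A)
    mA' = scale-monic a A (Deg≤-deg A) (trans (cong (a ·_) (coeff-deg A)) (Sign⇒i*i≡1 a a±))
    degA<n : deg A < n
    degA<n = subst (deg A <_) (trans (sym (deg-*ₚ A B A≉0 B≉0)) (trans (sym (deg-cong X≋AB)) (MonicOfDegree⇒deg X n mX)))
      (subst (_≤ deg A +ℕ deg B) (NP.+-comm (deg A) 1) (NP.+-monoʳ-≤ (deg A) (NP.n≢0⇒n>0 degB≢0)))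
    X≋A'B' : X ≋ scale a A *ₚ scale a B
    X≋A'B' = begin
      X                          ≈⟨ X≋AB ⟩
      A *ₚ B                     ≈⟨ *ₚ-congʳ B (scale-Sign-involutive a± A) ⟨
      scale a (scale a A) *ₚ B   ≈⟨ scale-*ₚˡ a (scale a A) B ⟩
      scale a (scale a A *ₚ B)   ≈⟨ scale-*ₚʳ a (scale a A) B ⟨
      scale a A *ₚ scale a B     ∎
      where open ≋-Reasoning

monicIrreducibleFactor : ∀ fuel X n → n < fuel → MonicOfDegree X n → 1 ≤ n →
  Σ Poly λ F → Σ ℕ λ d → MonicIrreducible F d × F ∣ X
monicIrreducibleFactor zero X n () _ _
monicIrreducibleFactor (suc fuel) X n n<1+fuel mX 1≤n with properMonicFactor? X n
... | inj₂ noProper = X , n , noProperFactor⇒MonicIrreducible X n mX 1≤n noProper , ∣-refl X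
... | inj₁ (g , e , mg , 1≤e , e<n , g∣X) with monicIrreducibleFactor fuel g e (NP.<-≤-trans e<n (NP.≤-pred n<1+fuel)) mg 1≤e
...   | F , d , irrF , F∣g = F , d , irrF , ∣-trans {F} {g} {X} F∣g g∣X

degree1⇒MonicIrreducible : ∀ F → MonicOfDegree F 1 → MonicIrreducible F 1
degree1⇒MonicIrreducible F mF = mk-irreducible mF NP.≤-refl constantFactor
  where
  constantFactor : ∀ X Y → F ≋ X *ₚ Y → deg X ≡ 0 ⊎ deg Y ≡ 0
  constantFactor X Y F≋XY with monicFactors F 1 X Y mF F≋XY
  ... | X≉0 , Y≉0 , _ with deg X | trans (sym (deg-*ₚ X Y X≉0 Y≉0)) (trans (sym (deg-cong F≋XY)) (MonicOfDegree⇒deg F 1 mF))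
  ...   | zero | _ = inj₁ refl
  ...   | suc zero | 1+degY≡1 = inj₂ (NP.+-cancelˡ-≡ 1 (deg Y) 0 1+degY≡1)
  ...   | suc (suc k) | ()

monic-*ₚ : ∀ {F G d e} → MonicOfDegree F d → MonicOfDegree G e → MonicOfDegree (F *ₚ G) (d +ℕ e)
monic-*ₚ {F} {G} {d} {e} (mk-monic F≤d F-top) (mk-monic G≤e G-top) with Deg≤-*ₚ F d G e F≤d G≤e
... | FG≤d+e , FG-top = mk-monic FG≤d+e (trans FG-top (cong₂ _·_ F-top G-top))

MonicOfDegree-≋ : ∀ {A B n k} → MonicOfDegree A n → MonicOfDegree B k → A ≋ B → n ≡ k
MonicOfDegree-≋ {A} {B} {n} {k} mA mB A≋B =
  trans (sym (MonicOfDegree⇒deg A n mA)) (trans (deg-cong A≋B) (MonicOfDegree⇒deg B k mB))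

monic-deg0⇒IsUnit : ∀ {A} → MonicOfDegree A 0 → IsUnit A
monic-deg0⇒IsUnit {A} mA =
  IsUnit-cong (≋-trans (Deg≤0⇒constant A (bounded mA)) (∷-cong (leading mA) ≋-refl)) (Sign⇒IsUnit 1ℤ (inj₁ refl))

deg-cofactor : ∀ {A D n d} H → MonicOfDegree A n → MonicOfDegree D d → A ≋ D *ₚ H → d +ℕ deg H ≡ n
deg-cofactor {A} {D} {n} {d} H mA mD A≋DH with monicFactors A n D H mA A≋DH
... | D≉0 , H≉0 , _ = begin
  d +ℕ deg H      ≡⟨ cong (_+ℕ deg H) (MonicOfDegree⇒deg D d mD) ⟨
  deg D +ℕ deg H  ≡⟨ deg-*ₚ D H D≉0 H≉0 ⟨
  deg (D *ₚ H)    ≡⟨ deg-cong A≋DH ⟨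
  deg A           ≡⟨ MonicOfDegree⇒deg A n mA ⟩
  n               ∎
  where open ≡-Reasoning

cofactor-monic : ∀ {A D n d} H → MonicOfDegree A n → MonicOfDegree D d → A ≋ D *ₚ H → MonicOfDegree H (deg H)
cofactor-monic {A} {D} {n} {d} H mA mD A≋DH with monicFactors A n D H mA A≋DH
... | _ , _ , leads = mk-monic (Deg≤-deg H) (begin
  coeff H (deg H)  ≡⟨ coeff-deg H ⟩
  lead H           ≡⟨ ZP.*-identityˡ (lead H) ⟨
  1ℤ · lead H      ≡⟨ cong (_· lead H) (MonicOfDegree⇒lead D d mD) ⟨
  lead D · lead H  ≡⟨ leads ⟩
  1ℤ               ∎)
  where open ≡-Reasoning

cofactor-deg≡0⇒≋ : ∀ {A D n d} H → MonicOfDegree A n → MonicOfDegree D d → A ≋ D *ₚ H → deg H ≡ 0 → A ≋ D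
cofactor-deg≡0⇒≋ {A} {D} H mA mD A≋DH degH≡0 = begin
  A         ≈⟨ A≋DH ⟩
  D *ₚ H    ≈⟨ *ₚ-congˡ D H≋1 ⟩
  D *ₚ 1ₚ   ≈⟨ *ₚ-comm D 1ₚ ⟩
  1ₚ *ₚ D   ≈⟨ *ₚ-identityˡ D ⟩
  D         ∎
  where
  open ≋-Reasoning
  H≋1 : H ≋ 1ₚ
  H≋1 = ≋-trans (deg≡0⇒constant H degH≡0)
          (∷-cong (trans (cong (coeff H) (sym degH≡0)) (leading (cofactor-monic H mA mD A≋DH))) ≋-refl)

monic-∣-sameDegree : ∀ {F G d} → MonicOfDegree F d → MonicOfDegree G d → F ∣ G → G ≋ F
monic-∣-sameDegree {F} {G} {d} mF mG (Q , G≋FQ) =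
  cofactor-deg≡0⇒≋ Q mG mF G≋FQ (NP.+-cancelˡ-≡ d (deg Q) 0 (trans (deg-cofactor Q mG mF G≋FQ) (sym (NP.+-identityʳ d))))

-- Reciprocal divisors

Palindromic : ℕ → Poly → Set
Palindromic n P = revAt n P ≋ P

reciprocal⇒palindromic : ∀ {A n} → MonicOfDegree A n → Reciprocal A → Palindromic n A
reciprocal⇒palindromic {A} {n} mA (inj₁ A≈0) = ⊥-elim (MonicOfDegree⇒NonZeroₚ A n mA (≈⇒≋ A≈0))
reciprocal⇒palindromic {A} {n} mA (inj₂ (_ , A≈revA)) =
  ≋-sym (≋-trans (≈⇒≋ A≈revA) (subst (λ k → rev A ≋ revAt k A) (MonicOfDegree⇒deg A n mA) (rev≋revAt A)))

SmallReciprocalDivisor : ℕ → Poly → Set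
SmallReciprocalDivisor m A =
  ∃ λ (D : Poly) → ∃ λ (k : ℕ) → 1 ≤ k × 2 * k ≤ m × Monic D × Reciprocal D × deg D ≡ 2 * k × D ∣ₚ A

IrreducibleTimesReversal : ℕ → Poly → Set
IrreducibleTimesReversal m A =
  ∃ λ (I : Poly) → ∃ λ (u : ℤ) → Monic I × Irreducible I × deg I ≡ m × Sign u × A ≈ₚ scale u (I *ₚ rev I)

2*≡+ : ∀ k → 2 * k ≡ k +ℕ k
2*≡+ k = cong (k +ℕ_) (NP.+-identityʳ k)

n+n≡m+m⇒n≡m : ∀ {n m} → n +ℕ n ≡ m +ℕ m → n ≡ m
n+n≡m+m⇒n≡m {n} {m} e = NP.*-cancelˡ-≡ n m 2 (trans (2*≡+ n) (trans e (sym (2*≡+ m))))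

1≤k+k⇒1≤k : ∀ {k} → 1 ≤ k +ℕ k → 1 ≤ k
1≤k+k⇒1≤k {suc k} _ = s≤s z≤n

complementaryHalf : ∀ {m h} k → k +ℕ k +ℕ h ≡ m +ℕ m → m < k +ℕ k → h ≢ 0 →
  ∃ λ j → h ≡ j +ℕ j × 1 ≤ j × j +ℕ j ≤ m
complementaryHalf {m} {h} k sum m<2k h≢0 =
  j , h≡2j , NP.n≢0⇒n>0 (λ j≡0 → h≢0 (trans h≡2j (cong (λ i → i +ℕ i) j≡0))) , 2j≤m
  where
  k≤m : k ≤ m
  k≤m = NP.*-cancelˡ-≤ 2 (subst₂ _≤_ (sym (2*≡+ k)) (trans sum (sym (2*≡+ m))) (NP.m≤m+n (k +ℕ k) h))
  j = m ∸ k
  k+j≡m : k +ℕ j ≡ m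
  k+j≡m = NP.m+[n∸m]≡n k≤m
  interchange : ∀ k j → (k +ℕ j) +ℕ (k +ℕ j) ≡ k +ℕ k +ℕ (j +ℕ j)
  interchange = NS.solve-∀
  h≡2j : h ≡ j +ℕ j
  h≡2j = NP.+-cancelˡ-≡ (k +ℕ k) h (j +ℕ j)
           (trans sum (trans (cong (λ i → i +ℕ i) (sym k+j≡m)) (interchange k j)))
  2j≤m : j +ℕ j ≤ m
  2j≤m = subst (j +ℕ j ≤_) k+j≡m
           (NP.+-monoˡ-≤ j (NP.<⇒≤ (NP.+-cancelˡ-< k j k (subst (_< k +ℕ k) (sym k+j≡m) m<2k))))

smallReciprocalDivisor : ∀ {A D k} m → 1 ≤ k → k +ℕ k ≤ m → MonicOfDegree D (k +ℕ k) → Palindromic (k +ℕ k) D →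
  D ∣ A → SmallReciprocalDivisor m A
smallReciprocalDivisor {A} {D} {k} m 1≤k 2k≤m mD pD (Q , A≋DQ) =
  D , k , 1≤k , subst (_≤ m) (sym (2*≡+ k)) 2k≤m , MonicOfDegree⇒lead D _ mD ,
  inj₂ ((k , degD) , ≋⇒≈ D (rev D) D≋revD) , trans degD (sym (2*≡+ k)) , Q , ≋⇒≈ A (D *ₚ Q) A≋DQ
  where
  degD : deg D ≡ k +ℕ k
  degD = MonicOfDegree⇒deg D _ mD
  D≋revD : D ≋ rev D
  D≋revD = ≋-sym (≋-trans (rev≋revAt D) (subst (λ n → revAt n D ≋ D) (sym degD) pD))

palindromic-cofactor : ∀ {A D d} H → MonicOfDegree D d → Palindromic (d +ℕ deg H) A → Palindromic d D →
  A ≋ D *ₚ H → Palindromic (deg H) H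
palindromic-cofactor {A} {D} {d} H mD pA pD A≋DH =
  ≋-sym (*ₚ-cancelˡ D H (revAt (deg H) H) (MonicOfDegree⇒NonZeroₚ D d mD) (begin
    D *ₚ H                           ≈⟨ A≋DH ⟨
    A                                ≈⟨ pA ⟨
    revAt (d +ℕ deg H) A             ≡⟨ revAt-cong (d +ℕ deg H) A≋DH ⟩
    revAt (d +ℕ deg H) (D *ₚ H)      ≈⟨ revAt-*ₚ D d H (deg H) (bounded mD) (Deg≤-deg H) ⟩
    revAt d D *ₚ revAt (deg H) H     ≈⟨ *ₚ-congʳ (revAt (deg H) H) pD ⟩
    D *ₚ revAt (deg H) H             ∎))
  where open ≋-Reasoning

cofactor⇒smallReciprocalDivisor : ∀ {A D} m k H → MonicOfDegree A (m +ℕ m) → Palindromic (m +ℕ m) A →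
  MonicOfDegree D (k +ℕ k) → Palindromic (k +ℕ k) D → A ≋ D *ₚ H → m < k +ℕ k → deg H ≢ 0 →
  SmallReciprocalDivisor m A
cofactor⇒smallReciprocalDivisor {A} {D} m k H mA pA mD pD A≋DH m<2k degH≢0
  with complementaryHalf k (deg-cofactor H mA mD A≋DH) m<2k degH≢0
... | j , degH≡2j , 1≤j , 2j≤m =
  smallReciprocalDivisor m 1≤j 2j≤m (subst (MonicOfDegree H) degH≡2j (cofactor-monic H mA mD A≋DH))
    (subst (λ n → Palindromic n H) degH≡2j pH) (D , ≋-trans A≋DH (*ₚ-comm D H))
  where
  pH : Palindromic (deg H) H
  pH = palindromic-cofactor H mD (subst (λ n → Palindromic n A) (sym (deg-cofactor H mA mD A≋DH)) pA) pD A≋DH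

reciprocalDivisor : ∀ {A D k} m → MonicOfDegree A (m +ℕ m) → Palindromic (m +ℕ m) A →
  1 ≤ k → MonicOfDegree D (k +ℕ k) → Palindromic (k +ℕ k) D → D ∣ A → SmallReciprocalDivisor m A ⊎ A ≋ D
reciprocalDivisor {A} {D} {k} m mA pA 1≤k mD pD (H , A≋DH) with k +ℕ k N.≤? m | deg H N.≟ 0
... | yes 2k≤m | _          = inj₁ (smallReciprocalDivisor m 1≤k 2k≤m mD pD (H , A≋DH))
... | no 2k≰m  | no degH≢0  = inj₁ (cofactor⇒smallReciprocalDivisor m k H mA pA mD pD A≋DH (NP.≰⇒> 2k≰m) degH≢0)
... | no _     | yes degH≡0 = inj₂ (cofactor-deg≡0⇒≋ H mA mD A≋DH degH≡0)

-- Roots at 1 and -1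

revAt-linear : ∀ {a} → Sign a → revAt 1 (linear a) ≋ scale (- a) (linear a)
revAt-linear (inj₁ refl) = ≋-refl
revAt-linear (inj₂ refl) = ≋-refl

linear²-monic : ∀ {a} → Sign a → MonicOfDegree (linear a *ₚ linear a) 2
linear²-monic (inj₁ refl) = mk-monic (λ { (suc (suc (suc k))) _ → refl ; zero () ; (suc zero) (s≤s ()) ; (suc (suc zero)) (s≤s (s≤s ())) }) refl
linear²-monic (inj₂ refl) = mk-monic (λ { (suc (suc (suc k))) _ → refl ; zero () ; (suc zero) (s≤s ()) ; (suc (suc zero)) (s≤s (s≤s ())) }) refl

linear²-palindromic : ∀ {a} → Sign a → Palindromic 2 (linear a *ₚ linear a)
linear²-palindromic (inj₁ refl) = ≈⇒≋ refl
linear²-palindromic (inj₂ refl) = ≈⇒≋ refl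

linear²≈ : ∀ {a} → Sign a → linear a *ₚ linear a ≈ₚ scale (- a) (linear a *ₚ rev (linear a))
linear²≈ (inj₁ refl) = refl
linear²≈ (inj₂ refl) = refl

-Sign : ∀ {a} → Sign a → Sign (- a)
-Sign (inj₁ refl) = inj₂ refl
-Sign (inj₂ refl) = inj₁ refl

-a·a^odd≡-1 : ∀ {a} → Sign a → ∀ k → (- a) · a ^ suc (k +ℕ k) ≡ - 1ℤ
-a·a^odd≡-1 (inj₁ refl) k = cong (- 1ℤ ·_) (ZP.^-zeroˡ (suc (k +ℕ k)))
-a·a^odd≡-1 (inj₂ refl) k = trans (ZP.*-identityˡ _) (-1^odd≡-1 k)

-- The cofactor of T - a in a reciprocal polynomial of even degree is anti-reciprocal of odd degree,
-- so it vanishes at a as well.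
doubleRoot : ∀ {A a} m → Sign a → MonicOfDegree A (suc m +ℕ suc m) → Palindromic (suc m +ℕ suc m) A →
  eval a A ≡ 0ℤ → linear a *ₚ linear a ∣ A
doubleRoot {A} {a} m a± mA pA A[a]≡0 = H , A≋L²H
  where
  L = linear a
  mL = linear-monic a
  G = proj₁ (factorTheorem a A A[a]≡0)
  A≋LG : A ≋ L *ₚ G
  A≋LG = proj₂ (factorTheorem a A A[a]≡0)
  1+degG : 1 +ℕ deg G ≡ suc m +ℕ suc m
  1+degG = deg-cofactor G mA mL A≋LG
  G* = revAt (deg G) G
  G≋-aG* : G ≋ scale (- a) G*
  G≋-aG* = *ₚ-cancelˡ L G (scale (- a) G*) (MonicOfDegree⇒NonZeroₚ L 1 mL) (begin
    L *ₚ G                       ≈⟨ A≋LG ⟨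
    A                            ≈⟨ pA ⟨
    revAt (suc m +ℕ suc m) A     ≡⟨ cong (λ n → revAt n A) (sym 1+degG) ⟩
    revAt (1 +ℕ deg G) A         ≡⟨ revAt-cong (1 +ℕ deg G) A≋LG ⟩
    revAt (1 +ℕ deg G) (L *ₚ G)  ≈⟨ revAt-*ₚ L 1 G (deg G) (bounded mL) (Deg≤-deg G) ⟩
    revAt 1 L *ₚ G*              ≈⟨ *ₚ-congʳ G* (revAt-linear a±) ⟩
    scale (- a) L *ₚ G*          ≈⟨ scale-*ₚˡ (- a) L G* ⟩
    scale (- a) (L *ₚ G*)        ≈⟨ scale-*ₚʳ (- a) L G* ⟨
    L *ₚ scale (- a) G*          ∎)
    where open ≋-Reasoning
  G[a]≡0 : eval a G ≡ 0ℤ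
  G[a]≡0 = i≡-i⇒i≡0 (eval a G) (begin
    eval a G                              ≡⟨ eval-cong a G≋-aG* ⟩
    eval a (scale (- a) G*)               ≡⟨ eval-scale a (- a) G* ⟩
    (- a) · eval a G*                     ≡⟨ cong ((- a) ·_) (eval-revAt a (Sign⇒i*i≡1 a a±) G (deg G) (Deg≤-deg G)) ⟩
    (- a) · (a ^ deg G · eval a G)        ≡⟨ ZP.*-assoc (- a) (a ^ deg G) (eval a G) ⟨
    (- a) · a ^ deg G · eval a G          ≡⟨ cong (λ n → (- a) · a ^ n · eval a G) degG ⟩
    (- a) · a ^ suc (m +ℕ m) · eval a G   ≡⟨ cong (_· eval a G) (-a·a^odd≡-1 a± m) ⟩
    - 1ℤ · eval a G                       ≡⟨ ZP.-1*i≡-i (eval a G) ⟩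
    - eval a G                            ∎)
    where
    open ≡-Reasoning
    degG : deg G ≡ suc (m +ℕ m)
    degG = trans (NP.suc-injective 1+degG) (NP.+-suc m m)
  H = proj₁ (factorTheorem a G G[a]≡0)
  A≋L²H : A ≋ (L *ₚ L) *ₚ H
  A≋L²H = ≋-trans A≋LG (≋-trans (*ₚ-congˡ L (proj₂ (factorTheorem a G G[a]≡0))) (≋-sym (*ₚ-assoc L L H)))

linear²⇒IrreducibleTimesReversal : ∀ {m A a} → Sign a → MonicOfDegree A (suc m +ℕ suc m) →
  A ≋ linear a *ₚ linear a → IrreducibleTimesReversal (suc m) A
linear²⇒IrreducibleTimesReversal {m} {A} {a} a± mA A≋L² =
  linear a , - a , MonicOfDegree⇒lead (linear a) 1 (linear-monic a) ,
  MonicIrreducible⇒Irreducible (linear a) 1 (degree1⇒MonicIrreducible (linear a) (linear-monic a)) ,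
  n+n≡m+m⇒n≡m (sym (MonicOfDegree-≋ mA (linear²-monic a±) A≋L²)) , -Sign a± ,
  trans (≋⇒≈ A (linear a *ₚ linear a) A≋L²) (linear²≈ a±)

rootCase : ∀ {m A a} → Sign a → MonicOfDegree A (m +ℕ m) → Palindromic (m +ℕ m) A → 1 ≤ m → eval a A ≡ 0ℤ →
  SmallReciprocalDivisor m A ⊎ IrreducibleTimesReversal m A
rootCase {suc m} {A} {a} a± mA pA _ A[a]≡0 = Sum.map₂ (linear²⇒IrreducibleTimesReversal a± mA)
  (reciprocalDivisor {k = 1} (suc m) mA pA (s≤s z≤n) (linear²-monic a±) (linear²-palindromic a±) (doubleRoot m a± mA pA A[a]≡0))

-- Irreducible factors without roots at 1 and -1

monicReversal : ℕ → Poly → Poly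
monicReversal d F = scale (coeff F 0) (revAt d F)

coeff0-Sign : ∀ {A n} F G → MonicOfDegree A n → Palindromic n A → A ≋ F *ₚ G → Sign (coeff F 0)
coeff0-Sign {A} {n} F G mA pA A≋FG = i*j≡1⇒Sign (coeff F 0) (coeff G 0) (begin
  coeff F 0 · coeff G 0  ≡⟨ coeff0-*ₚ F G ⟨
  coeff (F *ₚ G) 0       ≡⟨ at A≋FG 0 ⟨
  coeff A 0              ≡⟨ at pA 0 ⟨
  coeff (revAt n A) 0    ≡⟨ coeff-revAt-0 n A ⟩
  coeff A n              ≡⟨ leading mA ⟩
  1ℤ                     ∎)
  where open ≡-Reasoning

monicReversal-monic : ∀ {d} F → Sign (coeff F 0) → MonicOfDegree (monicReversal d F) d
monicReversal-monic {d} F c± =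
  scale-monic c (revAt d F) (Deg≤-revAt d F) (trans (cong (c ·_) (coeff-revAt-top d F)) (Sign⇒i*i≡1 c c±))
  where c = coeff F 0

revAt≋scale-monicReversal : ∀ d F → Sign (coeff F 0) → revAt d F ≋ scale (coeff F 0) (monicReversal d F)
revAt≋scale-monicReversal d F c± = ≋-sym (scale-Sign-involutive c± (revAt d F))

revAt-monicReversal : ∀ d F → Deg≤ F d → revAt d (monicReversal d F) ≋ scale (coeff F 0) F
revAt-monicReversal d F F≤d =
  ≋-trans (revAt-scale d (coeff F 0) (revAt d F)) (scale-cong (revAt-involutive d F F≤d))

monicReversal-∣ : ∀ {A F n d} G → MonicOfDegree A n → MonicOfDegree F d → Palindromic n A → A ≋ F *ₚ G →
  monicReversal d F ∣ A
monicReversal-∣ {A} {F} {n} {d} G mA mF pA A≋FG = scale c G* , (begin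
  A                            ≈⟨ pA ⟨
  revAt n A                    ≡⟨ cong (λ k → revAt k A) (sym (deg-cofactor G mA mF A≋FG)) ⟩
  revAt (d +ℕ deg G) A         ≡⟨ revAt-cong (d +ℕ deg G) A≋FG ⟩
  revAt (d +ℕ deg G) (F *ₚ G)  ≈⟨ revAt-*ₚ F d G (deg G) (bounded mF) (Deg≤-deg G) ⟩
  revAt d F *ₚ G*              ≈⟨ *ₚ-congʳ G* (revAt≋scale-monicReversal d F (coeff0-Sign F G mA pA A≋FG)) ⟩
  scale c F̃ *ₚ G*              ≈⟨ scale-*ₚˡ c F̃ G* ⟩
  scale c (F̃ *ₚ G*)            ≈⟨ scale-*ₚʳ c F̃ G* ⟨
  F̃ *ₚ scale c G*              ∎)
  where
  open ≋-Reasoning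
  c = coeff F 0
  F̃ = monicReversal d F
  G* = revAt (deg G) G

palindromic-*-monicReversal : ∀ d F → Sign (coeff F 0) → Deg≤ F d → Palindromic (d +ℕ d) (F *ₚ monicReversal d F)
palindromic-*-monicReversal d F c± F≤d = begin
  revAt (d +ℕ d) (F *ₚ F̃)          ≈⟨ revAt-*ₚ F d F̃ d F≤d (bounded (monicReversal-monic F c±)) ⟩
  revAt d F *ₚ revAt d F̃           ≈⟨ *ₚ-cong (revAt≋scale-monicReversal d F c±) (revAt-monicReversal d F F≤d) ⟩
  scale c F̃ *ₚ scale c F           ≈⟨ scale-*ₚˡ c F̃ (scale c F) ⟩
  scale c (F̃ *ₚ scale c F)         ≈⟨ scale-cong (scale-*ₚʳ c F̃ F) ⟩
  scale c (scale c (F̃ *ₚ F))       ≈⟨ scale-Sign-involutive c± (F̃ *ₚ F) ⟩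
  F̃ *ₚ F                           ≈⟨ *ₚ-comm F̃ F ⟩
  F *ₚ F̃                           ∎
  where
  open ≋-Reasoning
  c = coeff F 0
  F̃ = monicReversal d F

eval-factor≢0 : ∀ {A} F G x → A ≋ F *ₚ G → eval x A ≢ 0ℤ → eval x F ≢ 0ℤ
eval-factor≢0 {A} F G x A≋FG A[x]≢0 F[x]≡0 =
  A[x]≢0 (trans (eval-cong x A≋FG) (trans (eval-*ₚ x F G) (trans (cong (_· eval x G) F[x]≡0) (ZP.*-zeroˡ (eval x G)))))

eval-selfReversed : ∀ {F} d x → x · x ≡ 1ℤ → Deg≤ F d → F ≋ monicReversal d F →
  eval x F ≡ coeff F 0 · (x ^ d · eval x F)
eval-selfReversed {F} d x x²≡1 F≤d F≋F̃ =
  trans (eval-cong x F≋F̃) (trans (eval-scale x (coeff F 0) (revAt d F)) (cong (coeff F 0 ·_) (eval-revAt x x²≡1 F d F≤d)))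

-- F = ± T^d F(1/T) forces F(1) = 0 if the sign is -1, and F(-1) = 0 if the sign is 1 and d is odd.
selfReversed⇒palindromic : ∀ {F} d → Sign (coeff F 0) → Deg≤ F d → F ≋ monicReversal d F →
  eval 1ℤ F ≢ 0ℤ → eval (- 1ℤ) F ≢ 0ℤ → Even d × Palindromic d F
selfReversed⇒palindromic {F} d (inj₂ c≡-1) F≤d F≋F̃ F[1]≢0 _ = ⊥-elim (F[1]≢0 (i≡-i⇒i≡0 (eval 1ℤ F) (begin
  eval 1ℤ F                         ≡⟨ eval-selfReversed d _ refl F≤d F≋F̃ ⟩
  coeff F 0 · (1ℤ ^ d · eval 1ℤ F)  ≡⟨ cong₂ (λ c p → c · (p · eval 1ℤ F)) c≡-1 (ZP.^-zeroˡ d) ⟩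
  - 1ℤ · (1ℤ · eval 1ℤ F)           ≡⟨ cong (- 1ℤ ·_) (ZP.*-identityˡ (eval 1ℤ F)) ⟩
  - 1ℤ · eval 1ℤ F                  ≡⟨ ZP.-1*i≡-i (eval 1ℤ F) ⟩
  - eval 1ℤ F                       ∎)))
  where open ≡-Reasoning
selfReversed⇒palindromic {F} d (inj₁ c≡1) F≤d F≋F̃ _ F[-1]≢0 with even⊎odd d
... | inj₁ d-even = d-even , ≋-sym (≋-trans F≋F̃ (≋-trans (≋-reflexive (cong (λ c → scale c (revAt d F)) c≡1)) (scale-1 (revAt d F))))
... | inj₂ (k , d≡2k+1) = ⊥-elim (F[-1]≢0 (i≡-i⇒i≡0 (eval (- 1ℤ) F) (begin
  eval (- 1ℤ) F                                  ≡⟨ eval-selfReversed d _ refl F≤d F≋F̃ ⟩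
  coeff F 0 · ((- 1ℤ) ^ d · eval (- 1ℤ) F)       ≡⟨ cong₂ (λ c n → c · ((- 1ℤ) ^ n · eval (- 1ℤ) F)) c≡1 d≡2k+1 ⟩
  1ℤ · ((- 1ℤ) ^ suc (k +ℕ k) · eval (- 1ℤ) F)   ≡⟨ ZP.*-identityˡ _ ⟩
  (- 1ℤ) ^ suc (k +ℕ k) · eval (- 1ℤ) F          ≡⟨ cong (_· eval (- 1ℤ) F) (-1^odd≡-1 k) ⟩
  - 1ℤ · eval (- 1ℤ) F                           ≡⟨ ZP.-1*i≡-i (eval (- 1ℤ) F) ⟩
  - eval (- 1ℤ) F                                ∎)))
  where open ≡-Reasoning

selfReversedFactor : ∀ {A F d} m G → Reducible A → MonicOfDegree A (m +ℕ m) → Palindromic (m +ℕ m) A →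
  MonicIrreducible F d → A ≋ F *ₚ G → F ≋ monicReversal d F → eval 1ℤ A ≢ 0ℤ → eval (- 1ℤ) A ≢ 0ℤ →
  SmallReciprocalDivisor m A
selfReversedFactor {A} {F} {d} m G redA mA pA irrF A≋FG F≋F̃ A[1]≢0 A[-1]≢0
  with selfReversed⇒palindromic d (coeff0-Sign F G mA pA A≋FG) (bounded (isMonic irrF)) F≋F̃
         (eval-factor≢0 F G 1ℤ A≋FG A[1]≢0) (eval-factor≢0 F G (- 1ℤ) A≋FG A[-1]≢0)
... | (k , refl) , pF =
  Sum.fromInj₁ (⊥-elim ∘ A≉F) (reciprocalDivisor {k = k} m mA pA (1≤k+k⇒1≤k (1≤deg irrF)) (isMonic irrF) pF (G , A≋FG))
  where
  A≉F : ¬ (A ≋ F)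
  A≉F A≋F = Irreducible⇒¬Reducible A (Irreducible-cong A≋F (MonicIrreducible⇒Irreducible F _ irrF)) redA

-- F and its reversal are distinct irreducible factors, so by Euclid's lemma their product divides A.
*ₚ-monicReversal-∣ : ∀ {A F n d} G → MonicOfDegree A n → Palindromic n A → MonicIrreducible F d →
  A ≋ F *ₚ G → ¬ (F ≋ monicReversal d F) → F *ₚ monicReversal d F ∣ A
*ₚ-monicReversal-∣ {A} {F} {n} {d} G mA pA irrF A≋FG F≉F̃ with monicReversal-∣ G mA (isMonic irrF) pA A≋FG
... | W , A≋F̃W with euclidsLemmaₚ F d irrF (monicReversal d F) W (G , ≋-trans (≋-sym A≋F̃W) A≋FG)
...   | inj₁ F∣F̃ = ⊥-elim (F≉F̃ (≋-sym (monic-∣-sameDegree (isMonic irrF) (monicReversal-monic F (coeff0-Sign F G mA pA A≋FG)) F∣F̃)))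
...   | inj₂ (H , W≋FH) = H , (begin
  A                 ≈⟨ A≋F̃W ⟩
  F̃ *ₚ W            ≈⟨ *ₚ-congˡ F̃ W≋FH ⟩
  F̃ *ₚ (F *ₚ H)     ≈⟨ *ₚ-assoc F̃ F H ⟨
  (F̃ *ₚ F) *ₚ H     ≈⟨ *ₚ-congʳ H (*ₚ-comm F̃ F) ⟩
  (F *ₚ F̃) *ₚ H     ∎)
  where
  open ≋-Reasoning
  F̃ = monicReversal d F

distinctReversedFactor : ∀ {A F d} m G → MonicOfDegree A (m +ℕ m) → Palindromic (m +ℕ m) A →
  MonicIrreducible F d → A ≋ F *ₚ G → ¬ (F ≋ monicReversal d F) →
  SmallReciprocalDivisor m A ⊎ IrreducibleTimesReversal m A
distinctReversedFactor {A} {F} {d} m G mA pA irrF A≋FG F≉F̃ =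
  Sum.map₂ irreducibleTimesReversal
    (reciprocalDivisor m mA pA (1≤deg irrF) mFF̃ (palindromic-*-monicReversal d F c± (bounded mF))
       (*ₚ-monicReversal-∣ G mA pA irrF A≋FG F≉F̃))
  where
  mF = isMonic irrF
  c± = coeff0-Sign F G mA pA A≋FG
  mFF̃ = monic-*ₚ mF (monicReversal-monic F c±)
  irreducibleTimesReversal : A ≋ F *ₚ monicReversal d F → IrreducibleTimesReversal m A
  irreducibleTimesReversal A≋FF̃ =
    F , coeff F 0 , MonicOfDegree⇒lead F d mF , MonicIrreducible⇒Irreducible F d irrF ,
    trans (MonicOfDegree⇒deg F d mF) (n+n≡m+m⇒n≡m (sym (MonicOfDegree-≋ mA mFF̃ A≋FF̃))) , c± ,
    ≋⇒≈ A (scale (coeff F 0) (F *ₚ rev F)) (begin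
      A                                      ≈⟨ A≋FF̃ ⟩
      F *ₚ scale (coeff F 0) (revAt d F)     ≈⟨ scale-*ₚʳ (coeff F 0) F (revAt d F) ⟩
      scale (coeff F 0) (F *ₚ revAt d F)     ≈⟨ scale-cong (*ₚ-congˡ F revF≋revAt) ⟨
      scale (coeff F 0) (F *ₚ rev F)         ∎)
    where
    open ≋-Reasoning
    revF≋revAt : rev F ≋ revAt d F
    revF≋revAt = subst (λ k → rev F ≋ revAt k F) (MonicOfDegree⇒deg F d mF) (rev≋revAt F)

noUnitRootCase : ∀ {m A} → Reducible A → MonicOfDegree A (m +ℕ m) → Palindromic (m +ℕ m) A → 1 ≤ m →
  eval 1ℤ A ≢ 0ℤ → eval (- 1ℤ) A ≢ 0ℤ → SmallReciprocalDivisor m A ⊎ IrreducibleTimesReversal m A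
noUnitRootCase {m} {A} redA mA pA 1≤m A[1]≢0 A[-1]≢0
  with monicIrreducibleFactor (suc (m +ℕ m)) A (m +ℕ m) NP.≤-refl mA (NP.≤-trans 1≤m (NP.m≤m+n m m))
... | F , d , irrF , (G , A≋FG) with F ≋? monicReversal d F
...   | yes F≋F̃ = inj₁ (selfReversedFactor m G redA mA pA irrF A≋FG F≋F̃ A[1]≢0 A[-1]≢0)
...   | no F≉F̃  = distinctReversedFactor m G mA pA irrF A≋FG F≉F̃

reciprocalFactorisation : ∀ {m A} → Reducible A → MonicOfDegree A (m +ℕ m) → Palindromic (m +ℕ m) A → 1 ≤ m →
  SmallReciprocalDivisor m A ⊎ IrreducibleTimesReversal m A
reciprocalFactorisation {m} {A} redA mA pA 1≤m with eval 1ℤ A ZP.≟ 0ℤ | eval (- 1ℤ) A ZP.≟ 0ℤ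
... | yes A[1]≡0  | _            = rootCase (inj₁ refl) mA pA 1≤m A[1]≡0
... | no _        | yes A[-1]≡0  = rootCase (inj₂ refl) mA pA 1≤m A[-1]≡0
... | no A[1]≢0   | no A[-1]≢0   = noUnitRootCase redA mA pA 1≤m A[1]≢0 A[-1]≢0

lemma2p1 : (m : ℕ) (A : Poly) → Monic A → Reducible A → Reciprocal A → deg A ≡ 2 * m →
    (∃ λ (D : Poly) → ∃ λ (k : ℕ) → 1 ≤ k × 2 * k ≤ m × Monic D × Reciprocal D × deg D ≡ 2 * k × D ∣ₚ A)
    ⊎ (∃ λ (I : Poly) → ∃ λ (u : ℤ) → Monic I × Irreducible I × deg I ≡ m
        × (u ≡ + 1 ⊎ u ≡ -[1+ 0 ]) × A ≈ₚ scale u (I *ₚ rev I))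
lemma2p1 m A monA redA recA degA = reciprocalFactorisation redA mA (reciprocal⇒palindromic mA recA) 1≤m
  where
  mA : MonicOfDegree A (m +ℕ m)
  mA = monicOfDegree A (m +ℕ m) (trans degA (2*≡+ m)) monA
  1≤m : 1 ≤ m
  1≤m = NP.n≢0⇒n>0 λ m≡0 →
    proj₁ (proj₂ redA) (monic-deg0⇒IsUnit (subst (λ n → MonicOfDegree A (n +ℕ n)) m≡0 mA))
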